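{- Let $\mathbb{K}$ be a field of characteristic zero and let $\mathcal{M}$ be any minor-closed class of matroids containing every freedom matroid. Then the subalgebra of $\mathcal{A}(\mathcal{M})$ generated by the point $I$ and the loop $Z$ is free on these two generators.
   Context: All matroids are finite. A flag on a finite set $S$ is a sequence $(S_0,\dots,S_r)$ of subsets with $S_r=S$ and $S_{i-1}\subsetneq S_i$ for $1\le i\le r$; the freedom matroid $M(S_0,\dots,S_r)$ is the matroid on $S$ whose independent sets are the $I\subseteq S$ with $|I\cap S_i|\le i$ for all $i$. The point $I$ is the one-element matroid of rank 1 and the loop $Z$ the one-element matroid of rank 0. For matroids $N_1,N_2$ and $M=M(S)$, the section coefficient $\binom{M}{N_1,N_2}$ is the number of $A\subseteq S$ with $M|A\cong N_1$ and $M/A\cong N_2$. For a minor-closed class $\mathcal{M}$, $\mathcal{A}(\mathcal{M})$ is the free $\mathbb{K}$-module with basis the isomorphism classes of matroids in $\mathcal{M}$, with product $N_1\cdot N_2=\sum_{M}\binom{M}{N_1,N_2}M$ (sum over isomorphism classes in $\mathcal{M}$) and unit the empty matroid. -}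

module Defs where

open import Level using (Level; _⊔_)
open import Data.Bool using (Bool; true; false; if_then_else_; _∧_; not; T)
open import Data.Nat as ℕ using (ℕ; zero; suc; _≡ᵇ_; _≤ᵇ_; _<_)
open import Data.Fin using (Fin; toℕ; fromℕ; inject₁)
open import Data.Fin.Subset using (Subset; inside; outside; _∈_; _∉_; _⊆_; _⊂_; _∩_; _∪_; _─_; ∣_∣; ⁅_⁆; ⊥)
open import Data.Fin.Subset.Properties using (_⊆?_; _∈?_)
open import Data.Vec using (Vec; []; _∷_; tabulate; lookup)
open import Data.List using (List; []; _∷_; concatMap; foldr)
open import Data.Product using (Σ; ∃; _×_; _,_)
open import Relation.Nullary using (¬_)
open import Relation.Nullary.Decidable using (⌊_⌋)
open import Relation.Binary.PropositionalEquality using (_≡_)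
open import Algebra.Bundles using (CommutativeRing)

allSubsets : (n : ℕ) → List (Subset n)
allSubsets zero = [] ∷ []
allSubsets (suc n) = concatMap (λ s → (outside ∷ s) ∷ (inside ∷ s) ∷ []) (allSubsets n)

allFinᵇ : ∀ {k} → (Fin k → Bool) → Bool
allFinᵇ {zero} P = true
allFinᵇ {suc k} P = P Fin.zero ∧ allFinᵇ (λ i → P (Fin.suc i))

-- Matroids, presented on a ground set E ⊆ Fin size (so that restrictions
-- and contractions need no relabelling).  'ind' is the (raw, decidable)
-- independence test; only subsets of E are relevant (see Indep).

record SMatroid : Set where
  constructor smat
  field
    size : ℕ
    E    : Subset size
    ind  : Subset size → Bool

open SMatroid public

Indep : (M : SMatroid) → Subset (size M) → Set
Indep M X = X ⊆ E M × T (ind M X)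

record IsMatroid (M : SMatroid) : Set where
  field
    indep-empty : Indep M ⊥
    indep-hered : ∀ X Y → X ⊆ Y → Indep M Y → Indep M X
    indep-aug   : ∀ X Y → Indep M X → Indep M Y → ∣ X ∣ < ∣ Y ∣ →
                  ∃ λ e → e ∈ Y × e ∉ X × Indep M (X ∪ ⁅ e ⁆)

rank : (M : SMatroid) → Subset (size M) → ℕ
rank M X = foldr step 0 (allSubsets (size M))
  where
  step : Subset (size M) → ℕ → ℕ
  step Y acc = if ⌊ Y ⊆? X ⌋ ∧ ⌊ Y ⊆? E M ⌋ ∧ ind M Y then ∣ Y ∣ ℕ.⊔ acc else acc

restrict : (M : SMatroid) → Subset (size M) → SMatroid
restrict M A = smat (size M) (A ∩ E M) (ind M)

contract : (M : SMatroid) → Subset (size M) → SMatroid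
contract M A = smat (size M) (E M ─ A)
  (λ X → rank M (X ∪ (A ∩ E M)) ≡ᵇ (∣ X ∣ ℕ.+ rank M (A ∩ E M)))

pull : ∀ {n m} → (Fin m → Fin n) → Subset n → Subset m
pull g X = tabulate (λ j → lookup X (g j))

record Iso (M N : SMatroid) : Set where
  field
    f    : Fin (size M) → Fin (size N)
    g    : Fin (size N) → Fin (size M)
    f∈   : ∀ i → i ∈ E M → f i ∈ E N
    g∈   : ∀ j → j ∈ E N → g j ∈ E M
    gf   : ∀ i → i ∈ E M → g (f i) ≡ i
    fg   : ∀ j → j ∈ E N → f (g j) ≡ j
    pres : ∀ X → X ⊆ E M →
           (Indep M X → Indep N (pull g X ∩ E N)) × (Indep N (pull g X ∩ E N) → Indep M X)

record MinorClosedClass {p} (𝓜 : SMatroid → Set p) : Set p where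
  field
    matroids : ∀ M → 𝓜 M → IsMatroid M
    iso-closed : ∀ M N → 𝓜 M → Iso M N → 𝓜 N
    restrict-closed : ∀ M A → 𝓜 M → A ⊆ E M → 𝓜 (restrict M A)
    contract-closed : ∀ M A → 𝓜 M → A ⊆ E M → 𝓜 (contract M A)

record Flag (n : ℕ) : Set where
  field
    r      : ℕ
    S      : Fin (suc r) → Subset n
    strict : ∀ (i : Fin r) → S (inject₁ i) ⊂ S (Data.Fin.suc i)

freedom : ∀ {n} → Flag n → SMatroid
freedom {n} F = smat n (S (fromℕ r)) (λ X → allFinᵇ (λ i → ∣ X ∩ S i ∣ ≤ᵇ toℕ i))
  where open Flag F

module _ {c ℓ} (K : CommutativeRing c ℓ) where
  open CommutativeRing K

  record IsField : Set (c ⊔ ℓ) where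
    field
      1≉0 : ¬ (1# ≈ 0#)
      inv : ∀ x → ¬ (x ≈ 0#) → Σ Carrier λ y → x * y ≈ 1#

  natK : ℕ → Carrier
  natK zero = 0#
  natK (suc n) = 1# + natK n

  CharZero : Set ℓ
  CharZero = ∀ n → ¬ (natK (suc n) ≈ 0#)

-- The algebra A(𝓜), elements given by coefficient functions:
-- an element  Σ_[N] x_N · N  is  x : SMatroid → K  (x M = coefficient of [M]).
-- Bilinear extension of  N₁·N₂ = Σ_M (M choose N₁,N₂) M  gives
--   (x·y)(M) = Σ_{A ⊆ E(M)} x(M|A) · y(M/A).

  Coef : Set c
  Coef = SMatroid → Carrier

  sumK : List Carrier → Carrier
  sumK = foldr _+_ 0#

  mulC : Coef → Coef → Coef
  mulC x y M = foldr (λ A acc → if ⌊ A ⊆? E M ⌋ then x (restrict M A) * y (contract M A) + acc else acc)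
                     0# (allSubsets (size M))

  unitC : Coef
  unitC M = if ∣ E M ∣ ≡ᵇ 0 then 1# else 0#

  pointC : Coef
  pointC M = if (∣ E M ∣ ≡ᵇ 1) ∧ ind M (E M) then 1# else 0#

  loopC : Coef
  loopC M = if (∣ E M ∣ ≡ᵇ 1) ∧ not (ind M (E M)) then 1# else 0#

data Letter : Set where
  𝐼 𝑍 : Letter

Word : Set
Word = List Letter

_==L_ : Letter → Letter → Bool
𝐼 ==L 𝐼 = true
𝑍 ==L 𝑍 = true
_ ==L _ = false

_==W_ : Word → Word → Bool
[] ==W [] = true
(a ∷ u) ==W (b ∷ w) = (a ==L b) ∧ (u ==W w)
_ ==W _ = false

module _ {c ℓ} (K : CommutativeRing c ℓ) where
  open CommutativeRing K

  letterC : Letter → Coef K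
  letterC 𝐼 = pointC K
  letterC 𝑍 = loopC K

  wordC : Word → Coef K
  wordC [] = unitC K
  wordC (a ∷ w) = mulC K (letterC a) (wordC w)

  Poly : Set c
  Poly = List (Carrier × Word)

  evalC : Poly → Coef K
  evalC P M = foldr (λ { (a , w) acc → a * wordC w M + acc }) 0# P

  coeff : Poly → Word → Carrier
  coeff P u = foldr (λ { (a , w) acc → if w ==W u then a + acc else acc }) 0# P

-- A freedom matroid is described by levels h (the level of i is the least t with i ∈ Sₜ): a set X is
-- independent iff for every x at most x elements of X have level ≤ x. The loops are the elements of
-- level 0; contracting a loop leaves the levels alone and contracting a point of level t lowers every
-- level ≥ t by one, so single-element contractions stay freedom matroids. Since only one-element
-- restrictions can be isomorphic to I or Z, the coefficient of such an M in the word a₁⋯aₖ is the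
-- number of enumerations e₁, …, eₖ of its ground set in which eⱼ is a point (aⱼ = I) or a loop
-- (aⱼ = Z) of M / {e₁, …, eⱼ₋₁}.
--
-- For a word v, let M_v be the freedom matroid on the positions of v whose j-th position has as level
-- the number of I's among the first j letters. Enumerating the positions in order shows that the
-- coefficient of M_v in v is positive. If the coefficient of M_v in u is positive, then u is as long as
-- v and each prefix of u has at least as many I's as the prefix of v of the same length; so u = v or
-- u comes before v in the order of binary numerals with Z = 1 and I = 0. Evaluating a relation P at
-- M_v and inducting along this order, each coefficient of P times a positive integer vanishes, hence
-- vanishes in characteristic zero.

module Submission where

open import Defs
open import Algebra.Bundles using (CommutativeRing)
import Algebra.Properties.Monoid.Sum as MonoidSum
import Algebra.Properties.CommutativeSemigroup as CommutativeSemigroupProperties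
open import Data.Bool using (Bool; true; false; if_then_else_; _∧_; _∨_; not; T)
open import Data.Bool.Properties using (T-≡; T-∧; ⇔→≡; ∧-zeroʳ; ∧-identityʳ; ∨-zeroʳ; ∨-identityʳ)
open import Data.Empty using (⊥-elim)
open import Data.Fin as Fin using (Fin; toℕ; fromℕ; fromℕ<; inject₁)
open import Data.Fin.Properties using (toℕ-fromℕ; toℕ-fromℕ<; toℕ-inject₁; toℕ<n)
  renaming (suc-injective to Fin-suc-injective; _≟_ to _≟ᶠ_)
open import Data.Fin.Subset as Subset
  using (Subset; outside; inside; ⊤; ⁅_⁆; _∩_; _∪_; _─_; _-_; ∣_∣; _∈_; _∉_; _⊆_; _⊂_)
open import Data.Fin.Subset.Properties
  using (_⊆?_; _∈?_; ∣⁅x⁆∣≡1; ∣⊤∣≡n; ∣⊥∣≡0; x∈⁅x⁆; x∈⁅y⁆⇒x≡y; p─⊥≡p; ⊆-refl; ⊆-antisym; ⊆⊤; p─q⊆p;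
         p∩q⊆p; x∈p∩q⁺; p⊆p∪q; x∈p∪q⁻; ∪-identityˡ; p⊆q⇒∣p∣≤∣q∣; p⊂q⇒∣p∣<∣q∣)
open import Data.List using (List; []; _∷_; length; _++_; concatMap; foldr; map)
open import Data.List.Membership.Propositional using () renaming (_∈_ to _∈ˡ_)
open import Data.List.Membership.Propositional.Properties using (∈-concatMap⁺)
open import Data.List.Relation.Unary.Any as Any using (here; there)
open import Data.Nat as ℕ using (ℕ; zero; suc; _∸_; _^_; _≤_; _<_; z≤n; s≤s; z<s; _≡ᵇ_; _≤ᵇ_; _<ᵇ_; _⊔_)
open import Data.Nat.Induction using (<-rec)
open import Data.Nat.Properties as ℕₚ
  hiding (+-commutativeSemigroup; +-comm; +-identityʳ; +-identityˡ; +-assoc;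
          *-comm; *-assoc; *-identityˡ; *-identityʳ)
open import Data.Product using (∃; _×_; _,_; proj₁; proj₂)
open import Data.Sum using (inj₁; inj₂)
open import Data.Unit using (tt)
open import Data.Vec using ([]; _∷_; lookup; tabulate)
open import Data.Vec.Properties using (lookup-zipWith; lookup-replicate; lookup∘tabulate; []=⇒lookup; lookup⇒[]=)
open import Function using (_∘_; _⇔_; mk⇔; Equivalence)
import Function.Properties.Equivalence as ⇔
open import Relation.Binary.PropositionalEquality
  using (_≡_; _≢_; refl; sym; trans; cong; cong₂; subst; subst₂; module ≡-Reasoning)
open import Relation.Binary.Definitions using (tri<; tri≈; tri>)
open import Relation.Nullary using (¬_; Dec; yes; no; contradiction)
open import Relation.Nullary.Decidable using (⌊_⌋; dec-true; dec-false; does-⇔; isYes≗does; toWitness; fromWitness)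

open MonoidSum +-0-monoid using () renaming (sum to sumℕ; sum-cong-≗ to sumℕ-cong)

sumℕ-mono : ∀ {n} {f g : Fin n → ℕ} → (∀ i → f i ≤ g i) → sumℕ f ≤ sumℕ g
sumℕ-mono {zero}  _   = z≤n
sumℕ-mono {suc n} f≤g = +-mono-≤ (f≤g Fin.zero) (sumℕ-mono (f≤g ∘ Fin.suc))

term≤sumℕ : ∀ {n} (f : Fin n → ℕ) i → f i ≤ sumℕ f
term≤sumℕ f Fin.zero    = m≤m+n _ _
term≤sumℕ f (Fin.suc i) = ≤-trans (term≤sumℕ (f ∘ Fin.suc) i) (m≤n+m _ _)

sumℕ-positive : ∀ {n} (f : Fin n → ℕ) → 0 < sumℕ f → ∃ λ i → 0 < f i
sumℕ-positive {suc n} f pos with f Fin.zero in eq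
... | suc _ = Fin.zero , subst (0 <_) (sym eq) z<s
... | zero  with sumℕ-positive (f ∘ Fin.suc) pos
...   | i , pos-i = Fin.suc i , pos-i

𝟙 : Bool → ℕ
𝟙 true  = 1
𝟙 false = 0

𝟙-mono : ∀ {a b} → (T a → T b) → 𝟙 a ≤ 𝟙 b
𝟙-mono {false}        _   = z≤n
𝟙-mono {true} {true}  _   = ≤-refl
𝟙-mono {true} {false} a⇒b = ⊥-elim (a⇒b tt)

count : ∀ {n} → (Fin n → Bool) → ℕ
count P = sumℕ (𝟙 ∘ P)

count-cong : ∀ {n} {P Q : Fin n → Bool} → (∀ i → P i ≡ Q i) → count P ≡ count Q
count-cong P≗Q = sumℕ-cong (cong 𝟙 ∘ P≗Q)

count-mono : ∀ {n} {P Q : Fin n → Bool} → (∀ i → T (P i) → T (Q i)) → count P ≤ count Q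
count-mono P⇒Q = sumℕ-mono (𝟙-mono ∘ P⇒Q)

count-mono-< : ∀ {n} {P Q : Fin n → Bool} e → (∀ i → T (P i) → T (Q i)) →
               P e ≡ false → Q e ≡ true → count P < count Q
count-mono-< Fin.zero    P⇒Q Pe Qe rewrite Pe | Qe = s≤s (count-mono (P⇒Q ∘ Fin.suc))
count-mono-< (Fin.suc e) P⇒Q Pe Qe =
  +-mono-≤-< (𝟙-mono (P⇒Q Fin.zero)) (count-mono-< e (P⇒Q ∘ Fin.suc) Pe Qe)

count-split : ∀ {n} (P Q : Fin n → Bool) e → (∀ i → i ≢ e → P i ≡ Q i) →
              P e ≡ false → count Q ≡ 𝟙 (Q e) ℕ.+ count P
count-split P Q Fin.zero agree Pe rewrite Pe =
  cong (𝟙 (Q Fin.zero) ℕ.+_) (count-cong (λ i → sym (agree (Fin.suc i) λ ())))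
count-split P Q (Fin.suc e) agree Pe rewrite agree Fin.zero (λ ()) =
  trans (cong (𝟙 (Q Fin.zero) ℕ.+_) (count-split (P ∘ Fin.suc) (Q ∘ Fin.suc) e agree′ Pe))
        (x∙yz≈y∙xz (𝟙 (Q Fin.zero)) (𝟙 (Q (Fin.suc e))) (count (P ∘ Fin.suc)))
  where
  open CommutativeSemigroupProperties ℕₚ.+-commutativeSemigroup using (x∙yz≈y∙xz)
  agree′ : ∀ i → i ≢ e → P (Fin.suc i) ≡ Q (Fin.suc i)
  agree′ i i≢e = agree (Fin.suc i) (i≢e ∘ Fin-suc-injective)

count-false : ∀ {n} (P : Fin n → Bool) → (∀ i → P i ≡ false) → count P ≡ 0
count-false {zero}  P _      = refl
count-false {suc n} P P≡false rewrite P≡false Fin.zero = count-false (P ∘ Fin.suc) (P≡false ∘ Fin.suc)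

count-<ᵇ : ∀ {n} m → count (λ (i : Fin n) → toℕ i <ᵇ m) ≤ m
count-<ᵇ {zero}  m       = z≤n
count-<ᵇ {suc n} zero    = ≤-reflexive (count-false {suc n} (λ i → toℕ i <ᵇ 0) (λ _ → refl))
count-<ᵇ {suc n} (suc m) = s≤s (count-<ᵇ {n} m)

∣∣≡count : ∀ {n} (p : Subset n) → ∣ p ∣ ≡ count (lookup p)
∣∣≡count []          = refl
∣∣≡count (true ∷ p)  = cong suc (∣∣≡count p)
∣∣≡count (false ∷ p) = ∣∣≡count p

count-single : ∀ {n} (e : Fin n) (P : Fin n → Bool) → count (λ i → lookup ⁅ e ⁆ i ∧ P i) ≡ 𝟙 (P e)
count-single {suc n} Fin.zero P =
  trans (cong (𝟙 (P Fin.zero) ℕ.+_) (count-false _ (λ i → cong (_∧ P (Fin.suc i)) (lookup-replicate i outside))))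
        (ℕₚ.+-identityʳ _)
count-single (Fin.suc e) P = count-single e (P ∘ Fin.suc)

lookup-∩ : ∀ {n} (p q : Subset n) i → lookup (p ∩ q) i ≡ lookup p i ∧ lookup q i
lookup-∩ p q i = lookup-zipWith _∧_ i p q

lookup-∪ : ∀ {n} (p q : Subset n) i → lookup (p ∪ q) i ≡ lookup p i ∨ lookup q i
lookup-∪ p q i = lookup-zipWith _∨_ i p q

lookup-─ : ∀ {n} (p q : Subset n) i → lookup (p ─ q) i ≡ lookup p i ∧ not (lookup q i)
lookup-─ (x ∷ p) (true ∷ q)  Fin.zero    = sym (∧-zeroʳ x)
lookup-─ (x ∷ p) (false ∷ q) Fin.zero    = sym (∧-identityʳ x)
lookup-─ (x ∷ p) (y ∷ q)     (Fin.suc i) = lookup-─ p q i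

lookup-⁅⁆-self : ∀ {n} (e : Fin n) → lookup ⁅ e ⁆ e ≡ true
lookup-⁅⁆-self e = []=⇒lookup (x∈⁅x⁆ e)

lookup-⁅⁆-other : ∀ {n} {i e : Fin n} → i ≢ e → lookup ⁅ e ⁆ i ≡ false
lookup-⁅⁆-other {i = Fin.zero}  {Fin.zero}  i≢e = contradiction refl i≢e
lookup-⁅⁆-other {i = Fin.zero}  {Fin.suc e} _   = refl
lookup-⁅⁆-other {i = Fin.suc i} {Fin.zero}  _   = lookup-replicate i outside
lookup-⁅⁆-other {i = Fin.suc i} {Fin.suc e} i≢e = lookup-⁅⁆-other (i≢e ∘ cong Fin.suc)

lookup-remove-self : ∀ {n} (D : Subset n) e → lookup (D - e) e ≡ false
lookup-remove-self D e rewrite lookup-─ D ⁅ e ⁆ e | lookup-⁅⁆-self e = ∧-zeroʳ _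

lookup-remove-other : ∀ {n} (D : Subset n) {i e} → i ≢ e → lookup (D - e) i ≡ lookup D i
lookup-remove-other D {i} {e} i≢e rewrite lookup-─ D ⁅ e ⁆ i | lookup-⁅⁆-other i≢e = ∧-identityʳ _

lookup-remove-⊆ : ∀ {n} (D : Subset n) e i → lookup (D - e) i ≡ true → lookup D i ≡ true
lookup-remove-⊆ D e i i∈D-e with i ≟ᶠ e
... | yes refl = contradiction (trans (sym i∈D-e) (lookup-remove-self D e)) λ ()
... | no  i≢e  = trans (sym (lookup-remove-other D i≢e)) i∈D-e

lookup-insert-self : ∀ {n} (X : Subset n) e → lookup (X ∪ ⁅ e ⁆) e ≡ true
lookup-insert-self X e rewrite lookup-∪ X ⁅ e ⁆ e | lookup-⁅⁆-self e = ∨-zeroʳ _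

lookup-insert-other : ∀ {n} (X : Subset n) {i e} → i ≢ e → lookup (X ∪ ⁅ e ⁆) i ≡ lookup X i
lookup-insert-other X {i} {e} i≢e rewrite lookup-∪ X ⁅ e ⁆ i | lookup-⁅⁆-other i≢e = ∨-identityʳ _

∣remove∣ : ∀ {n} (D : Subset n) {e} → lookup D e ≡ true → ∣ D ∣ ≡ suc ∣ D - e ∣
∣remove∣ D {e} e∈D = begin
  ∣ D ∣
    ≡⟨ ∣∣≡count D ⟩
  count (lookup D)
    ≡⟨ count-split _ _ e (λ _ → lookup-remove-other D) (lookup-remove-self D e) ⟩
  𝟙 (lookup D e) ℕ.+ count (lookup (D - e))
    ≡⟨ cong (λ b → 𝟙 b ℕ.+ count (lookup (D - e))) e∈D ⟩
  suc (count (lookup (D - e)))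
    ≡⟨ cong suc (∣∣≡count (D - e)) ⟨
  suc ∣ D - e ∣
    ∎
  where open ≡-Reasoning

#𝐼 : Word → ℕ
#𝐼 []      = 0
#𝐼 (𝐼 ∷ w) = suc (#𝐼 w)
#𝐼 (𝑍 ∷ w) = #𝐼 w

prefix#𝐼 : Word → ℕ → ℕ
prefix#𝐼 w       zero    = 0
prefix#𝐼 []      (suc j) = 0
prefix#𝐼 (𝐼 ∷ w) (suc j) = suc (prefix#𝐼 w j)
prefix#𝐼 (𝑍 ∷ w) (suc j) = prefix#𝐼 w j

prefix#𝐼≤#𝐼 : ∀ w j → prefix#𝐼 w j ≤ #𝐼 w
prefix#𝐼≤#𝐼 w       zero    = z≤n
prefix#𝐼≤#𝐼 []      (suc j) = z≤n
prefix#𝐼≤#𝐼 (𝐼 ∷ w) (suc j) = s≤s (prefix#𝐼≤#𝐼 w j)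
prefix#𝐼≤#𝐼 (𝑍 ∷ w) (suc j) = prefix#𝐼≤#𝐼 w j

prefix#𝐼-mono : ∀ w {i j} → i ≤ j → prefix#𝐼 w i ≤ prefix#𝐼 w j
prefix#𝐼-mono w       {zero}              _         = z≤n
prefix#𝐼-mono []      {suc i} {suc j} _         = z≤n
prefix#𝐼-mono (𝐼 ∷ w) {suc i} {suc j} (s≤s i≤j) = s≤s (prefix#𝐼-mono w i≤j)
prefix#𝐼-mono (𝑍 ∷ w) {suc i} {suc j} (s≤s i≤j) = prefix#𝐼-mono w i≤j

prefix#𝐼-hits : ∀ v t → 1 ≤ t → t ≤ #𝐼 v → ∃ λ (i : Fin (length v)) → prefix#𝐼 v (suc (toℕ i)) ≡ t
prefix#𝐼-hits []      t             1≤t t≤0 = contradiction (≤-trans 1≤t t≤0) λ ()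
prefix#𝐼-hits (𝐼 ∷ v) 1             _   _   = Fin.zero , refl
prefix#𝐼-hits (𝐼 ∷ v) (suc (suc t)) _   (s≤s t≤) with prefix#𝐼-hits v (suc t) (s≤s z≤n) t≤
... | i , hit = Fin.suc i , cong suc hit
prefix#𝐼-hits (𝑍 ∷ v) t             1≤t t≤  with prefix#𝐼-hits v t 1≤t t≤
... | i , hit = Fin.suc i , hit

≤ᵇ-true : ∀ {a x} → a ≤ x → (a ≤ᵇ x) ≡ true
≤ᵇ-true = Equivalence.to T-≡ ∘ ≤⇒≤ᵇ

≤ᵇ-false : ∀ {a x} → x < a → (a ≤ᵇ x) ≡ false
≤ᵇ-false {a} {x} x<a with a ≤ᵇ x in eq
... | true  = contradiction (≤ᵇ⇒≤ a x (subst T (sym eq) tt)) (<⇒≱ x<a)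
... | false = refl

<ᵇ-true⇒< : ∀ {a t} → (a <ᵇ t) ≡ true → a < t
<ᵇ-true⇒< {a} {t} eq = <ᵇ⇒< a t (Equivalence.from T-≡ eq)

<ᵇ-false⇒≥ : ∀ {a t} → (a <ᵇ t) ≡ false → t ≤ a
<ᵇ-false⇒≥ eq = ≮⇒≥ (λ a<t → subst T eq (<⇒<ᵇ a<t))

∧≤ᵇ-suc : ∀ b a x → T (b ∧ (a ≤ᵇ x)) → T (b ∧ (a ≤ᵇ suc x))
∧≤ᵇ-suc true a x a≤x = ≤⇒≤ᵇ (m≤n⇒m≤1+n (≤ᵇ⇒≤ a x a≤x))

Levels : ℕ → Set
Levels n = Fin n → ℕ

-- Contracting a non-loop of level t removes the t-th set of the flag, so levels ≥ t drop by one.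
lowerFrom : ℕ → ℕ → ℕ
lowerFrom t a = if a <ᵇ t then a else a ∸ 1

lowerFrom-≤ : ∀ t a → lowerFrom t a ≤ a
lowerFrom-≤ t a with a <ᵇ t
... | true  = ≤-refl
... | false = m∸n≤m a 1

lowerFrom-below : ∀ t a x → suc x < t → (lowerFrom t a ≤ᵇ x) ≡ (a ≤ᵇ x)
lowerFrom-below t a x x+1<t with a <ᵇ t in eq
... | true  = refl
... | false = trans (≤ᵇ-false (∸-monoˡ-≤ 1 x+2≤a)) (sym (≤ᵇ-false (<-trans (n<1+n x) x+2≤a)))
  where x+2≤a = ≤-trans x+1<t (<ᵇ-false⇒≥ eq)

lowerFrom-above : ∀ t a x → t ≤ suc x → (lowerFrom t a ≤ᵇ x) ≡ (a ≤ᵇ suc x)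
lowerFrom-above t a x t≤x+1 with a <ᵇ t in eq
... | true  = trans (≤ᵇ-true a≤x) (sym (≤ᵇ-true (m≤n⇒m≤1+n a≤x)))
  where a≤x = ≤-pred (≤-trans (<ᵇ-true⇒< eq) t≤x+1)
... | false = pred-≤ᵇ a
  where
  pred-≤ᵇ : ∀ a → (a ∸ 1 ≤ᵇ x) ≡ (a ≤ᵇ suc x)
  pred-≤ᵇ zero          = refl
  pred-≤ᵇ (suc zero)    = refl
  pred-≤ᵇ (suc (suc a)) = refl

lowerFrom-> : ∀ t a y → t ≤ y → y < lowerFrom t a → suc y < a
lowerFrom-> t a y t≤y y<a′ with a <ᵇ t in eq
... | true  = contradiction (<-trans y<a′ (<ᵇ-true⇒< eq)) (≤⇒≯ t≤y)
... | false with a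
...   | suc a = s≤s y<a′

levelCount : ∀ {n} → Levels n → Subset n → ℕ → ℕ
levelCount h X x = count (λ i → lookup X i ∧ (h i ≤ᵇ x))

levelCount-suc : ∀ {n} h (X : Subset n) x → levelCount h X x ≤ levelCount h X (suc x)
levelCount-suc h X x = count-mono (λ i → ∧≤ᵇ-suc (lookup X i) (h i) x)

levelCount-step : ∀ {n} h (X : Subset n) {e x} → lookup X e ≡ true → h e ≡ suc x →
                  levelCount h X x < levelCount h X (suc x)
levelCount-step h X {e} {x} X∋e he≡x+1 =
  count-mono-< e (λ i → ∧≤ᵇ-suc (lookup X i) (h i) x)
    (cong₂ _∧_ X∋e (≤ᵇ-false (≤-reflexive (sym he≡x+1)))) (cong₂ _∧_ X∋e (≤ᵇ-true (≤-reflexive he≡x+1)))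

levelCount-remove : ∀ {n} h (D : Subset n) {e} → lookup D e ≡ true → ∀ x →
                    levelCount h D x ≡ 𝟙 (h e ≤ᵇ x) ℕ.+ levelCount h (D - e) x
levelCount-remove h D {e} D∋e x =
  trans (count-split _ _ e (λ i i≢e → cong (_∧ (h i ≤ᵇ x)) (lookup-remove-other D i≢e))
                           (cong (_∧ (h e ≤ᵇ x)) (lookup-remove-self D e)))
        (cong (λ b → 𝟙 (b ∧ (h e ≤ᵇ x)) ℕ.+ levelCount h (D - e) x) D∋e)

levelCount-insert : ∀ {n} h (X : Subset n) {e} → lookup X e ≡ false → ∀ x →
                    levelCount h (X ∪ ⁅ e ⁆) x ≡ 𝟙 (h e ≤ᵇ x) ℕ.+ levelCount h X x
levelCount-insert h X {e} X∌e x =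
  trans (count-split _ _ e (λ i i≢e → cong (_∧ (h i ≤ᵇ x)) (sym (lookup-insert-other X i≢e)))
                           (cong (_∧ (h e ≤ᵇ x)) X∌e))
        (cong (λ b → 𝟙 (b ∧ (h e ≤ᵇ x)) ℕ.+ levelCount h X x) (lookup-insert-self X e))

levelCount-lower-below : ∀ {n} h (X : Subset n) t x → suc x < t →
                         levelCount (lowerFrom t ∘ h) X x ≡ levelCount h X x
levelCount-lower-below h X t x x+1<t =
  count-cong (λ i → cong (lookup X i ∧_) (lowerFrom-below t (h i) x x+1<t))

levelCount-lower-above : ∀ {n} h (X : Subset n) t x → t ≤ suc x →
                         levelCount (lowerFrom t ∘ h) X x ≡ levelCount h X (suc x)
levelCount-lower-above h X t x t≤x+1 =
  count-cong (λ i → cong (lookup X i ∧_) (lowerFrom-above t (h i) x t≤x+1))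

levelCount-contract-below : ∀ {n} h (D : Subset n) {e} → lookup D e ≡ true → ∀ x → suc x < h e →
                            levelCount (lowerFrom (h e) ∘ h) (D - e) x ≡ levelCount h D x
levelCount-contract-below h D {e} D∋e x x+1<he = begin
  levelCount (lowerFrom (h e) ∘ h) (D - e) x ≡⟨ levelCount-lower-below h (D - e) (h e) x x+1<he ⟩
  levelCount h (D - e) x
    ≡⟨ cong (λ b → 𝟙 b ℕ.+ levelCount h (D - e) x) (≤ᵇ-false (<-trans (n<1+n x) x+1<he)) ⟨
  𝟙 (h e ≤ᵇ x) ℕ.+ levelCount h (D - e) x  ≡⟨ levelCount-remove h D D∋e x ⟨
  levelCount h D x                         ∎
  where open ≡-Reasoning

levelCount-contract-above : ∀ {n} h (D : Subset n) {e} → lookup D e ≡ true → ∀ x → h e ≤ suc x →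
                            suc (levelCount (lowerFrom (h e) ∘ h) (D - e) x) ≡ levelCount h D (suc x)
levelCount-contract-above h D {e} D∋e x he≤x+1 = begin
  suc (levelCount (lowerFrom (h e) ∘ h) (D - e) x)
    ≡⟨ cong suc (levelCount-lower-above h (D - e) (h e) x he≤x+1) ⟩
  suc (levelCount h (D - e) (suc x))
    ≡⟨ cong (λ b → 𝟙 b ℕ.+ levelCount h (D - e) (suc x)) (≤ᵇ-true he≤x+1) ⟨
  𝟙 (h e ≤ᵇ suc x) ℕ.+ levelCount h (D - e) (suc x)
    ≡⟨ levelCount-remove h D D∋e (suc x) ⟨
  levelCount h D (suc x)
    ∎
  where open ≡-Reasoning

levelCount-remove-loop : ∀ {n} h (D : Subset n) {e} → lookup D e ≡ true → h e ≡ 0 → ∀ x →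
                         levelCount h D x ≡ suc (levelCount h (D - e) x)
levelCount-remove-loop h D {e} D∋e he≡0 x =
  trans (levelCount-remove h D D∋e x) (cong (λ l → 𝟙 (l ≤ᵇ x) ℕ.+ levelCount h (D - e) x) he≡0)

Gapless : ∀ {n} → Subset n → Levels n → Set
Gapless D h = ∀ x e → lookup D e ≡ true → suc x < h e → levelCount h D x < levelCount h D (suc x)

gapless-remove-loop : ∀ {n} (D : Subset n) h {e} → Gapless D h → lookup D e ≡ true → h e ≡ 0 →
                      Gapless (D - e) h
gapless-remove-loop D h {e} gapless D∋e he≡0 x e′ D-e∋e′ x+1<he′ =
  ≤-pred (subst₂ _<_ (removeLoop x) (removeLoop (suc x))
                     (gapless x e′ (lookup-remove-⊆ D e e′ D-e∋e′) x+1<he′))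
  where removeLoop = levelCount-remove-loop h D D∋e he≡0

gapless-contract : ∀ {n} (D : Subset n) h {e} → Gapless D h → lookup D e ≡ true →
                   Gapless (D - e) (lowerFrom (h e) ∘ h)
gapless-contract D h {e} gapless D∋e x e′ D-e∋e′ x+1<h′e′
  with <-cmp (suc (suc x)) (h e)
... | tri< x+2<he _ _ =
  subst₂ _<_ (sym (below x (<-trans (n<1+n _) x+2<he))) (sym (below (suc x) x+2<he))
             (gapless x e′ D∋e′ (<-≤-trans x+1<h′e′ (lowerFrom-≤ (h e) (h e′))))
  where D∋e′ = lookup-remove-⊆ D e e′ D-e∋e′
        below = levelCount-contract-below h D D∋e
... | tri≈ _ x+2≡he _ = ≤-pred (begin-strict
  suc (levelCount h′ (D - e) x)        ≡⟨ cong suc (below x (≤-reflexive x+2≡he)) ⟩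
  suc (levelCount h D x)               <⟨ s≤s (gapless x e D∋e (≤-reflexive x+2≡he)) ⟩
  suc (levelCount h D (suc x))         ≤⟨ levelCount-step h D D∋e (sym x+2≡he) ⟩
  levelCount h D (suc (suc x))         ≡⟨ above (suc x) (≤-reflexive (sym x+2≡he)) ⟨
  suc (levelCount h′ (D - e) (suc x))  ∎)
  where open ≤-Reasoning
        h′ = lowerFrom (h e) ∘ h
        below = levelCount-contract-below h D D∋e
        above = levelCount-contract-above h D D∋e
... | tri> _ _ he<x+2 =
  ≤-pred (subst₂ _<_ (sym (above x he≤x+1)) (sym (above (suc x) (m≤n⇒m≤1+n he≤x+1)))
                     (gapless (suc x) e′ D∋e′ (lowerFrom-> (h e) (h e′) (suc x) he≤x+1 x+1<h′e′)))
  where D∋e′ = lookup-remove-⊆ D e e′ D-e∋e′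
        he≤x+1 = ≤-pred he<x+2
        above = levelCount-contract-above h D D∋e

-- Orderings and their triangularity

matches : Letter → ℕ → Bool
matches 𝐼 l = 1 ≤ᵇ l
matches 𝑍 l = l ≡ᵇ 0

afterContracting : ∀ {n} → Letter → Levels n → Fin n → Levels n
afterContracting 𝐼 h e = lowerFrom (h e) ∘ h
afterContracting 𝑍 h e = h

-- The number of enumerations e₁, …, eₖ of D in which each eⱼ is a point (for 𝐼) or a loop (for 𝑍)
-- of the matroid with levels h after e₁, …, eⱼ₋₁ have been contracted.
orderings : Word → ∀ {n} → Subset n → Levels n → ℕ
orderings []      D h = if ∣ D ∣ ≡ᵇ 0 then 1 else 0
orderings (a ∷ w) D h = sumℕ λ i →
  if lookup D i ∧ matches a (h i) then orderings w (D - i) (afterContracting a h i) else 0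

PrefixBound : Word → ∀ {n} → Subset n → Levels n → Set
PrefixBound w D h = ∀ j → j ≤ length w → j ≤ levelCount h D (prefix#𝐼 w j)

prefixBound-𝑍 : ∀ w {n} (D : Subset n) h {e} → lookup D e ≡ true → h e ≡ 0 →
                PrefixBound w (D - e) h → PrefixBound (𝑍 ∷ w) D h
prefixBound-𝑍 w D h D∋e he≡0 bound zero    _     = z≤n
prefixBound-𝑍 w D h D∋e he≡0 bound (suc j) j<len =
  subst (suc j ≤_) (sym (levelCount-remove-loop h D D∋e he≡0 (prefix#𝐼 w j))) (s≤s (bound j (≤-pred j<len)))

prefixBound-𝐼 : ∀ w {n} (D : Subset n) h {e} → Gapless D h → lookup D e ≡ true →
                PrefixBound w (D - e) (lowerFrom (h e) ∘ h) → PrefixBound (𝐼 ∷ w) D h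
prefixBound-𝐼 w D h     gapless D∋e bound zero    _     = z≤n
prefixBound-𝐼 w D h {e} gapless D∋e bound (suc j) j<len = step (h e ≤? suc y)
  where
  y = prefix#𝐼 w j
  j≤ = bound j (≤-pred j<len)
  step : Dec (h e ≤ suc y) → suc j ≤ levelCount h D (suc y)
  step (yes he≤y+1) = ≤-trans (s≤s j≤) (≤-reflexive (levelCount-contract-above h D D∋e y he≤y+1))
  step (no  he≰y+1) = ≤-trans (s≤s (≤-trans j≤ (≤-reflexive (levelCount-contract-below h D D∋e y y+1<he))))
                              (gapless y e D∋e y+1<he)
    where y+1<he = ≰⇒> he≰y+1

orderings-support : ∀ w {n} (D : Subset n) h → Gapless D h → 0 < orderings w D h →
                    length w ≡ ∣ D ∣ × PrefixBound w D h
orderings-support [] D h _ positive with ∣ D ∣ ≡ᵇ 0 in empty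
... | true = sym (≡ᵇ⇒≡ _ 0 (Equivalence.from T-≡ empty)) , λ { zero _ → z≤n }
orderings-support (a ∷ w) D h gapless positive with sumℕ-positive _ positive
... | i , positive-i with lookup D i in D∋i | matches a (h i) in match
...   | false | _     = contradiction positive-i (<-irrefl refl)
...   | true  | false = contradiction positive-i (<-irrefl refl)
orderings-support (𝑍 ∷ w) D h gapless positive | i , positive-i | true | true =
  let hi≡0            = ≡ᵇ⇒≡ _ 0 (Equivalence.from T-≡ match)
      (length≡ , bound) = orderings-support w (D - i) h (gapless-remove-loop D h gapless D∋i hi≡0) positive-i
  in trans (cong suc length≡) (sym (∣remove∣ D D∋i)) , prefixBound-𝑍 w D h D∋i hi≡0 bound
orderings-support (𝐼 ∷ w) D h gapless positive | i , positive-i | true | true =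
  let (length≡ , bound) = orderings-support w (D - i) (lowerFrom (h i) ∘ h)
                                             (gapless-contract D h gapless D∋i) positive-i
  in trans (cong suc length≡) (sym (∣remove∣ D D∋i)) , prefixBound-𝐼 w D h gapless D∋i bound

wordLevels : (v : Word) → Levels (length v)
wordLevels v i = prefix#𝐼 v (suc (toℕ i))

wordLevels≤#𝐼 : ∀ v i → wordLevels v i ≤ #𝐼 v
wordLevels≤#𝐼 v i = prefix#𝐼≤#𝐼 v (suc (toℕ i))

wordLevels-hits : ∀ v (t : Fin (#𝐼 v)) → ∃ λ i → wordLevels v i ≡ suc (toℕ t)
wordLevels-hits v t = prefix#𝐼-hits v (suc (toℕ t)) (s≤s z≤n) (toℕ<n t)

Dominates : Word → Word → Set
Dominates u v = ∀ j → j ≤ length v → prefix#𝐼 v j ≤ prefix#𝐼 u j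

levelCount-wordLevels : ∀ v (D : Subset (length v)) {y j} → y < prefix#𝐼 v (suc j) →
                        levelCount (wordLevels v) D y ≤ j
levelCount-wordLevels v D {y} {j} y<v = ≤-trans (count-mono before-j) (count-<ᵇ {length v} j)
  where
  before-j : ∀ i → T (lookup D i ∧ (wordLevels v i ≤ᵇ y)) → T (toℕ i <ᵇ j)
  before-j i D∋i,level≤y with suc (toℕ i) ≤? j
  ... | yes i<j = <⇒<ᵇ i<j
  ... | no  i≮j = contradiction (≤ᵇ⇒≤ _ y (proj₂ (Equivalence.to T-∧ D∋i,level≤y)))
                                (<⇒≱ (<-≤-trans y<v (prefix#𝐼-mono v (≰⇒> i≮j))))

prefixBound⇒dominates : ∀ u v (D : Subset (length v)) → length u ≡ length v →
                        PrefixBound u D (wordLevels v) → Dominates u v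
prefixBound⇒dominates u v D _   _     zero    _     = z≤n
prefixBound⇒dominates u v D len bound (suc j) j<len = ≮⇒≥ λ u<v →
  <-irrefl refl (≤-trans (bound (suc j) (subst (suc j ≤_) (sym len) j<len)) (levelCount-wordLevels v D u<v))

index : Word → ℕ
index []      = 0
index (𝐼 ∷ w) = index w
index (𝑍 ∷ w) = 2 ^ length w ℕ.+ index w

index<2^length : ∀ w → index w < 2 ^ length w
index<2^length []      = z<s
index<2^length (𝐼 ∷ w) = ≤-trans (index<2^length w) (m≤m+n _ _)
index<2^length (𝑍 ∷ w) = +-monoʳ-< (2 ^ length w) (≤-trans (index<2^length w) (m≤m+n _ 0))

dominates⇒index< : ∀ u v → length u ≡ length v → Dominates u v → u ≢ v → index u < index v
dominates⇒index< []      []      _   _   u≢v = contradiction refl u≢v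
dominates⇒index< (𝐼 ∷ u) (𝐼 ∷ v) len dom u≢v =
  dominates⇒index< u v (suc-injective len) (λ j j≤ → ≤-pred (dom (suc j) (s≤s j≤))) (u≢v ∘ cong (𝐼 ∷_))
dominates⇒index< (𝑍 ∷ u) (𝑍 ∷ v) len dom u≢v rewrite suc-injective len =
  +-monoʳ-< (2 ^ length v)
    (dominates⇒index< u v (suc-injective len) (λ j j≤ → dom (suc j) (s≤s j≤)) (u≢v ∘ cong (𝑍 ∷_)))
dominates⇒index< (𝐼 ∷ u) (𝑍 ∷ v) len _   _   =
  <-≤-trans (index<2^length u) (≤-trans (≤-reflexive (cong (2 ^_) (suc-injective len))) (m≤m+n _ _))
dominates⇒index< (𝑍 ∷ u) (𝐼 ∷ v) _   dom _   with dom 1 (s≤s z≤n)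
... | ()

wordLevels-gapless : ∀ v → Gapless ⊤ (wordLevels v)
wordLevels-gapless v x e _ x+1<level
  with prefix#𝐼-hits v (suc x) (s≤s z≤n) (<⇒≤ (<-≤-trans x+1<level (wordLevels≤#𝐼 v e)))
... | i , level≡x+1 = levelCount-step (wordLevels v) ⊤ (lookup-replicate i true) level≡x+1

orderings-triangular : ∀ u v → 0 < orderings u ⊤ (wordLevels v) →
                       length u ≡ length v × (u ≢ v → index u < index v)
orderings-triangular u v positive =
  let (length≡ , bound) = orderings-support u ⊤ (wordLevels v) (wordLevels-gapless v) positive
      length≡′ = trans length≡ (∣⊤∣≡n (length v))
  in length≡′ , dominates⇒index< u v length≡′ (prefixBound⇒dominates u v ⊤ length≡′ bound)

-- The letter has to be concrete for afterContracting to commute with Fin.suc definitionally.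
orderings-drop-outside : ∀ w {n} (D : Subset n) h → orderings w (outside ∷ D) h ≡ orderings w D (h ∘ Fin.suc)
orderings-drop-outside []      D h = refl
orderings-drop-outside (𝐼 ∷ w) D h = sumℕ-cong λ i →
  cong (λ k → if lookup D i ∧ matches 𝐼 (h (Fin.suc i)) then k else 0)
       (orderings-drop-outside w (D - i) (afterContracting 𝐼 h (Fin.suc i)))
orderings-drop-outside (𝑍 ∷ w) D h = sumℕ-cong λ i →
  cong (λ k → if lookup D i ∧ matches 𝑍 (h (Fin.suc i)) then k else 0)
       (orderings-drop-outside w (D - i) (afterContracting 𝑍 h (Fin.suc i)))

orderings-summand≤ : ∀ a w {n} (D : Subset n) h i →
                     (if lookup D i ∧ matches a (h i) then orderings w (D - i) (afterContracting a h i) else 0)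
                       ≤ orderings (a ∷ w) D h
orderings-summand≤ a w D h =
  term≤sumℕ (λ i → if lookup D i ∧ matches a (h i) then orderings w (D - i) (afterContracting a h i) else 0)

-- Enumerating the positions of v from left to right realises v.
orderings-diagonal : ∀ v → 0 < orderings v ⊤ (wordLevels v)
orderings-diagonal []      = z<s
orderings-diagonal (a ∷ v) = <-≤-trans (orderings-diagonal v) (first a)
  where
  ⊤─⊥ : orderings v (⊤ ─ Subset.⊥) (wordLevels v) ≡ orderings v ⊤ (wordLevels v)
  ⊤─⊥ = cong (λ D → orderings v D (wordLevels v)) (p─⊥≡p ⊤)
  first : ∀ a → orderings v ⊤ (wordLevels v) ≤ orderings (a ∷ v) ⊤ (wordLevels (a ∷ v))
  first 𝐼 = ≤-trans (≤-reflexive (sym (trans (orderings-drop-outside v _ _) ⊤─⊥)))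
                    (orderings-summand≤ 𝐼 v ⊤ (wordLevels (𝐼 ∷ v)) Fin.zero)
  first 𝑍 = ≤-trans (≤-reflexive (sym (trans (orderings-drop-outside v _ _) ⊤─⊥)))
                    (orderings-summand≤ 𝑍 v ⊤ (wordLevels (𝑍 ∷ v)) Fin.zero)

-- Levelled matroids

T⇔T⇒≡ : ∀ {a b} → T a ⇔ T b → a ≡ b
T⇔T⇒≡ a⇔b = ⇔→≡ (⇔.trans (⇔.sym T-≡) (⇔.trans a⇔b T-≡))

⌊⌋-⇔ : ∀ {p q} {A : Set p} {B : Set q} → A ⇔ B → (a? : Dec A) (b? : Dec B) → ⌊ a? ⌋ ≡ ⌊ b? ⌋
⌊⌋-⇔ A⇔B a? b? = trans (isYes≗does a?) (trans (does-⇔ A⇔B a? b?) (sym (isYes≗does b?)))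

⌊⌋-true : ∀ {p} {A : Set p} (a? : Dec A) → A → ⌊ a? ⌋ ≡ true
⌊⌋-true a? a = trans (isYes≗does a?) (dec-true a? a)

⌊⌋-false : ∀ {p} {A : Set p} (a? : Dec A) → ¬ A → ⌊ a? ⌋ ≡ false
⌊⌋-false a? ¬a = trans (isYes≗does a?) (dec-false a? ¬a)

∉⇒lookup : ∀ {n} {p : Subset n} {x} → x ∉ p → lookup p x ≡ false
∉⇒lookup {p = p} {x} x∉p with lookup p x in px
... | true  = contradiction (lookup⇒[]= x p px) x∉p
... | false = refl

⊆⇒∩≡ : ∀ {n} {A D : Subset n} → A ⊆ D → A ∩ D ≡ A
⊆⇒∩≡ {A = A} {D} A⊆D = ⊆-antisym (p∩q⊆p A D) (λ i∈A → x∈p∩q⁺ (i∈A , A⊆D i∈A))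

⁅⁆⊆ : ∀ {n} {e : Fin n} {D} → e ∈ D → ⁅ e ⁆ ⊆ D
⁅⁆⊆ {e = e} e∈D i∈⁅e⁆ rewrite x∈⁅y⁆⇒x≡y e i∈⁅e⁆ = e∈D

⁅⁆⊈ : ∀ {n} {D : Subset n} {e} → lookup D e ≡ false → ¬ ⁅ e ⁆ ⊆ D
⁅⁆⊈ {e = e} D∌e ⁅e⁆⊆D = contradiction (trans (sym ([]=⇒lookup (⁅e⁆⊆D (x∈⁅x⁆ e)))) D∌e) λ ()

∪-⊆ : ∀ {n} {X Y D : Subset n} → X ⊆ D → Y ⊆ D → X ∪ Y ⊆ D
∪-⊆ {X = X} {Y} X⊆D Y⊆D i∈X∪Y with x∈p∪q⁻ X Y i∈X∪Y
... | inj₁ i∈X = X⊆D i∈X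
... | inj₂ i∈Y = Y⊆D i∈Y

∣insert∣ : ∀ {n} (X : Subset n) {e} → e ∉ X → ∣ X ∪ ⁅ e ⁆ ∣ ≡ suc ∣ X ∣
∣insert∣ X {e} e∉X = begin
  ∣ X ∪ ⁅ e ⁆ ∣
    ≡⟨ ∣∣≡count (X ∪ ⁅ e ⁆) ⟩
  count (lookup (X ∪ ⁅ e ⁆))
    ≡⟨ count-split _ _ e (λ _ i≢e → sym (lookup-insert-other X i≢e)) (∉⇒lookup e∉X) ⟩
  𝟙 (lookup (X ∪ ⁅ e ⁆) e) ℕ.+ count (lookup X)
    ≡⟨ cong (λ b → 𝟙 b ℕ.+ count (lookup X)) (lookup-insert-self X e) ⟩
  suc (count (lookup X))
    ≡⟨ cong suc (∣∣≡count X) ⟨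
  suc ∣ X ∣
    ∎
  where open ≡-Reasoning

⊆-∣∣≡⇒≡ : ∀ {n} {X Y : Subset n} → X ⊆ Y → ∣ X ∣ ≡ ∣ Y ∣ → X ≡ Y
⊆-∣∣≡⇒≡ {X = X} {Y} X⊆Y ∣X∣≡∣Y∣ = ⊆-antisym X⊆Y Y⊆X
  where
  Y⊆X : Y ⊆ X
  Y⊆X {i} i∈Y with i ∈? X
  ... | yes i∈X = i∈X
  ... | no  i∉X = contradiction ∣X∣≡∣Y∣ (<⇒≢ (p⊂q⇒∣p∣<∣q∣ (X⊆Y , i , i∈Y , i∉X)))

∈-allSubsets : ∀ n (Y : Subset n) → Y ∈ˡ allSubsets n
∈-allSubsets zero    []          = here refl
∈-allSubsets (suc n) (false ∷ Y) = ∈-concatMap⁺ _ (Any.map (λ { refl → here refl }) (∈-allSubsets n Y))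
∈-allSubsets (suc n) (true ∷ Y)  = ∈-concatMap⁺ _ (Any.map (λ { refl → there (here refl) }) (∈-allSubsets n Y))

maxSize : ∀ {n} → (Subset n → Bool) → List (Subset n) → ℕ
maxSize g = foldr (λ Y acc → if g Y then ∣ Y ∣ ⊔ acc else acc) 0

size≤maxSize : ∀ {n} (g : Subset n → Bool) {Y} L → Y ∈ˡ L → T (g Y) → ∣ Y ∣ ≤ maxSize g L
size≤maxSize g (Y ∷ L) (here refl) gY rewrite Equivalence.to T-≡ gY = m≤m⊔n _ _
size≤maxSize g (Z ∷ L) (there Y∈L) gY with g Z
... | true  = ≤-trans (size≤maxSize g L Y∈L gY) (m≤n⊔m _ _)
... | false = size≤maxSize g L Y∈L gY

maxSize≤ : ∀ {n} (g : Subset n → Bool) L {b} → (∀ Y → T (g Y) → ∣ Y ∣ ≤ b) → maxSize g L ≤ b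
maxSize≤ g []      _     = z≤n
maxSize≤ g (Y ∷ L) bound with g Y in gY
... | true  = ⊔-lub (bound Y (Equivalence.from T-≡ gY)) (maxSize≤ g L bound)
... | false = maxSize≤ g L bound

maxSize-attained : ∀ {n} (g : Subset n → Bool) L → 0 < maxSize g L →
                   ∃ λ Y → T (g Y) × maxSize g L ≡ ∣ Y ∣
maxSize-attained g (Y ∷ L) positive with g Y in gY
... | false = maxSize-attained g L positive
... | true with ⊔-sel ∣ Y ∣ (maxSize g L)
...   | inj₁ max≡Y    = Y , Equivalence.from T-≡ gY , max≡Y
...   | inj₂ max≡rest =
  let (Z , gZ , rest≡Z) = maxSize-attained g L (subst (0 <_) max≡rest positive)
  in Z , gZ , trans max≡rest rest≡Z

maxSize-cong : ∀ {n} {g g′ : Subset n → Bool} L → (∀ Y → g Y ≡ g′ Y) → maxSize g L ≡ maxSize g′ L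
maxSize-cong []      _    = refl
maxSize-cong (Y ∷ L) g≗g′ rewrite g≗g′ Y | maxSize-cong L g≗g′ = refl

-- rank M X unfolds to maxSize (rankCandidate M X) (allSubsets (size M)).
rankCandidate : (M : SMatroid) → Subset (size M) → Subset (size M) → Bool
rankCandidate M X Y = ⌊ Y ⊆? X ⌋ ∧ ⌊ Y ⊆? E M ⌋ ∧ ind M Y

rankCandidate⇒ : ∀ M X Y → T (rankCandidate M X Y) → Y ⊆ X × Y ⊆ E M × T (ind M Y)
rankCandidate⇒ M X Y candidate =
  let (Y⊆X , rest)  = Equivalence.to (T-∧ {⌊ Y ⊆? X ⌋}) candidate
      (Y⊆E , indY) = Equivalence.to (T-∧ {⌊ Y ⊆? E M ⌋}) rest
  in toWitness {a? = Y ⊆? X} Y⊆X , toWitness {a? = Y ⊆? E M} Y⊆E , indY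

rankCandidate⇐ : ∀ M X Y → Y ⊆ X → Y ⊆ E M → T (ind M Y) → T (rankCandidate M X Y)
rankCandidate⇐ M X Y Y⊆X Y⊆E indY =
  Equivalence.from (T-∧ {⌊ Y ⊆? X ⌋})
    (fromWitness {a? = Y ⊆? X} Y⊆X ,
     Equivalence.from (T-∧ {⌊ Y ⊆? E M ⌋}) (fromWitness {a? = Y ⊆? E M} Y⊆E , indY))

Sparse : ∀ {n} → Levels n → Subset n → Set
Sparse h X = ∀ x → levelCount h X x ≤ x

-- M is the freedom matroid of the flag Sₜ = {i : h i ≤ t}, since ∣ I ∩ Sₜ ∣ = levelCount h I t.
Levelled : (M : SMatroid) → Levels (size M) → Set
Levelled M h = ∀ X → X ⊆ E M → T (ind M X) ⇔ Sparse h X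

levelCount≤size : ∀ {n} h (X : Subset n) x → levelCount h X x ≤ ∣ X ∣
levelCount≤size h X x =
  ≤-trans (count-mono {P = λ i → lookup X i ∧ (h i ≤ᵇ x)} {Q = lookup X} (λ i → proj₁ ∘ Equivalence.to T-∧))
          (≤-reflexive (sym (∣∣≡count X)))

rank≡size⇔independent : ∀ {M h} → Levelled M h → ∀ X → X ⊆ E M → rank M X ≡ ∣ X ∣ ⇔ T (ind M X)
rank≡size⇔independent {M} {h} levelled X X⊆E = mk⇔ to from
  where
  to : rank M X ≡ ∣ X ∣ → T (ind M X)
  to rank≡size with ∣ X ∣ in size≡
  ... | zero  = Equivalence.from (levelled X X⊆E)
                  (λ x → ≤-trans (levelCount≤size h X x) (≤-trans (≤-reflexive size≡) z≤n))
  ... | suc _ with maxSize-attained (rankCandidate M X) (allSubsets (size M)) (subst (0 <_) (sym rank≡size) z<s)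
  ...   | Y , candidate , rank≡∣Y∣ =
    let (Y⊆X , _ , indY) = rankCandidate⇒ M X Y candidate
    in subst (T ∘ ind M) (⊆-∣∣≡⇒≡ Y⊆X (trans (sym rank≡∣Y∣) (trans rank≡size (sym size≡)))) indY
  from : T (ind M X) → rank M X ≡ ∣ X ∣
  from indX = ≤-antisym
    (maxSize≤ (rankCandidate M X) (allSubsets (size M)) λ Y → p⊆q⇒∣p∣≤∣q∣ ∘ proj₁ ∘ rankCandidate⇒ M X Y)
    (size≤maxSize (rankCandidate M X) (allSubsets (size M)) (∈-allSubsets (size M) X)
                  (rankCandidate⇐ M X X ⊆-refl X⊆E indX))

loop∉independent : ∀ {M h} → Levelled M h → ∀ {e} → h e ≡ 0 → ∀ Y → Y ⊆ E M → T (ind M Y) → e ∉ Y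
loop∉independent {M} {h} levelled {e} he≡0 Y Y⊆E indY e∈Y =
  contradiction (≤-trans e-counted (Equivalence.to (levelled Y Y⊆E) indY 0)) λ ()
  where
  e-counted : 1 ≤ levelCount h Y 0
  e-counted = subst (λ b → 𝟙 b ≤ levelCount h Y 0) (cong₂ _∧_ ([]=⇒lookup e∈Y) (cong (_≤ᵇ 0) he≡0))
                    (term≤sumℕ (λ i → 𝟙 (lookup Y i ∧ (h i ≤ᵇ 0))) e)

rank-∪-loop : ∀ {M h} → Levelled M h → ∀ {e} → h e ≡ 0 → ∀ X → rank M (X ∪ ⁅ e ⁆) ≡ rank M X
rank-∪-loop {M} {h} levelled {e} he≡0 X = maxSize-cong (allSubsets (size M)) same-candidates
  where
  same-candidates : ∀ Y → rankCandidate M (X ∪ ⁅ e ⁆) Y ≡ rankCandidate M X Y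
  same-candidates Y with ⌊ Y ⊆? E M ⌋ ∧ ind M Y in rest
  ... | false = trans (∧-zeroʳ _) (sym (∧-zeroʳ _))
  ... | true  = cong (_∧ true) (⌊⌋-⇔ (mk⇔ drop-e (λ Y⊆X → p⊆p∪q ⁅ e ⁆ ∘ Y⊆X)) (Y ⊆? X ∪ ⁅ e ⁆) (Y ⊆? X))
    where
    Y⊆E,indY = Equivalence.to (T-∧ {⌊ Y ⊆? E M ⌋}) (Equivalence.from T-≡ rest)
    e∉Y = loop∉independent {M} {h} levelled he≡0 Y (toWitness {a? = Y ⊆? E M} (proj₁ Y⊆E,indY)) (proj₂ Y⊆E,indY)
    drop-e : Y ⊆ X ∪ ⁅ e ⁆ → Y ⊆ X
    drop-e Y⊆X∪e {i} i∈Y with x∈p∪q⁻ X ⁅ e ⁆ (Y⊆X∪e i∈Y)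
    ... | inj₁ i∈X   = i∈X
    ... | inj₂ i∈⁅e⁆ rewrite x∈⁅y⁆⇒x≡y e i∈⁅e⁆ = contradiction i∈Y e∉Y

rank-⊥ : ∀ M → rank M Subset.⊥ ≡ 0
rank-⊥ M = n≤0⇒n≡0 (maxSize≤ (rankCandidate M Subset.⊥) (allSubsets (size M))
  λ Y candidate → ≤-trans (p⊆q⇒∣p∣≤∣q∣ (proj₁ (rankCandidate⇒ M Subset.⊥ Y candidate)))
                          (≤-reflexive (∣⊥∣≡0 (size M))))

rank-loop : ∀ {M h} → Levelled M h → ∀ {e} → h e ≡ 0 → rank M ⁅ e ⁆ ≡ 0
rank-loop {M} {h} levelled {e} he≡0 =
  trans (cong (rank M) (sym (∪-identityˡ ⁅ e ⁆))) (trans (rank-∪-loop {M} {h} levelled he≡0 Subset.⊥) (rank-⊥ M))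

sparse-singleton : ∀ {n} (h : Levels n) e → Sparse h ⁅ e ⁆ ⇔ T (1 ≤ᵇ h e)
sparse-singleton h e = mk⇔ to from
  where
  to : Sparse h ⁅ e ⁆ → T (1 ≤ᵇ h e)
  to sparse with h e in he
  ... | suc _ = tt
  ... | zero  =
    contradiction (subst (_≤ 0) (trans (count-single e _) (cong (λ l → 𝟙 (l ≤ᵇ 0)) he)) (sparse 0)) λ ()
  𝟙≤1 : ∀ b → 𝟙 b ≤ 1
  𝟙≤1 true  = ≤-refl
  𝟙≤1 false = z≤n
  from : T (1 ≤ᵇ h e) → Sparse h ⁅ e ⁆
  from 1≤he zero    = ≤-reflexive (trans (count-single e _) (cong 𝟙 (≤ᵇ-false (≤ᵇ⇒≤ 1 (h e) 1≤he))))
  from 1≤he (suc x) = ≤-trans (≤-reflexive (count-single e _)) (≤-trans (𝟙≤1 (h e ≤ᵇ suc x)) (s≤s z≤n))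

independent-singleton : ∀ {M h} → Levelled M h → ∀ {e} → e ∈ E M → ind M ⁅ e ⁆ ≡ (1 ≤ᵇ h e)
independent-singleton {M} {h} levelled {e} e∈E =
  T⇔T⇒≡ (⇔.trans (levelled ⁅ e ⁆ (⁅⁆⊆ e∈E)) (sparse-singleton h e))

sparse-insert : ∀ {n} h (X : Subset n) {e} → e ∉ X → 1 ≤ h e →
                Sparse h (X ∪ ⁅ e ⁆) ⇔ Sparse (lowerFrom (h e) ∘ h) X
sparse-insert h X {e} e∉X 1≤he = mk⇔ to from
  where
  open ≤-Reasoning
  h′ = lowerFrom (h e) ∘ h
  insert = levelCount-insert h X (∉⇒lookup e∉X)

  to : Sparse h (X ∪ ⁅ e ⁆) → Sparse h′ X
  to sparse x with suc x <? h e
  ... | yes x+1<he = begin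
    levelCount h′ X x                  ≡⟨ levelCount-lower-below h X (h e) x x+1<he ⟩
    levelCount h X x                   ≤⟨ m≤n+m _ _ ⟩
    𝟙 (h e ≤ᵇ x) ℕ.+ levelCount h X x  ≡⟨ insert x ⟨
    levelCount h (X ∪ ⁅ e ⁆) x         ≤⟨ sparse x ⟩
    x                                  ∎
  ... | no x+1≮he = ≤-pred (begin
    suc (levelCount h′ X x)                      ≡⟨ cong suc (levelCount-lower-above h X (h e) x he≤x+1) ⟩
    suc (levelCount h X (suc x))                 ≡⟨ cong (λ b → 𝟙 b ℕ.+ levelCount h X (suc x)) (≤ᵇ-true he≤x+1) ⟨
    𝟙 (h e ≤ᵇ suc x) ℕ.+ levelCount h X (suc x)  ≡⟨ insert (suc x) ⟨
    levelCount h (X ∪ ⁅ e ⁆) (suc x)             ≤⟨ sparse (suc x) ⟩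
    suc x                                        ∎)
    where he≤x+1 = ≮⇒≥ x+1≮he

  unlowered≤lowered : ∀ x → x < h e → levelCount h X x ≤ levelCount h′ X x
  unlowered≤lowered x x<he with suc x <? h e
  ... | yes x+1<he = ≤-reflexive (sym (levelCount-lower-below h X (h e) x x+1<he))
  ... | no  x+1≮he = ≤-trans (levelCount-suc h X x)
                             (≤-reflexive (sym (levelCount-lower-above h X (h e) x (≮⇒≥ x+1≮he))))

  from : Sparse h′ X → Sparse h (X ∪ ⁅ e ⁆)
  from sparse x with h e ≤? x
  from sparse zero    | yes he≤0   = contradiction (≤-trans 1≤he he≤0) λ ()
  from sparse (suc x) | yes he≤x+1 = begin
    levelCount h (X ∪ ⁅ e ⁆) (suc x)             ≡⟨ insert (suc x) ⟩
    𝟙 (h e ≤ᵇ suc x) ℕ.+ levelCount h X (suc x)  ≡⟨ cong (λ b → 𝟙 b ℕ.+ levelCount h X (suc x)) (≤ᵇ-true he≤x+1) ⟩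
    suc (levelCount h X (suc x))                 ≡⟨ cong suc (levelCount-lower-above h X (h e) x he≤x+1) ⟨
    suc (levelCount h′ X x)                      ≤⟨ s≤s (sparse x) ⟩
    suc x                                        ∎
  from sparse x       | no  he≰x   = begin
    levelCount h (X ∪ ⁅ e ⁆) x         ≡⟨ insert x ⟩
    𝟙 (h e ≤ᵇ x) ℕ.+ levelCount h X x  ≡⟨ cong (λ b → 𝟙 b ℕ.+ levelCount h X x) (≤ᵇ-false (≰⇒> he≰x)) ⟩
    levelCount h X x                   ≤⟨ unlowered≤lowered x (≰⇒> he≰x) ⟩
    levelCount h′ X x                  ≤⟨ sparse x ⟩
    x                                  ∎

T-≡ᵇ : ∀ {m n} → T (m ≡ᵇ n) ⇔ (m ≡ n)
T-≡ᵇ {m} {n} = mk⇔ (≡ᵇ⇒≡ m n) (≡⇒≡ᵇ m n)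

-- The independent sets of M / {e} are the X with r(X ∪ {e}) = ∣ X ∣ + r({e}); for a loop e this is
-- independence of X in M, for a point e it is independence of X ∪ {e}.
contract-levelled : ∀ {M h} → Levelled M h → ∀ {e} → e ∈ E M → ∀ a → T (matches a (h e)) →
                    Levelled (contract M ⁅ e ⁆) (afterContracting a h e)
contract-levelled {M} {h} levelled {e} e∈E a match X X⊆E-e = go a match
  where
  X⊆E : X ⊆ E M
  X⊆E = p─q⊆p (E M) ⁅ e ⁆ ∘ X⊆E-e
  e∉X : e ∉ X
  e∉X e∈X = contradiction (trans (sym ([]=⇒lookup (X⊆E-e e∈X))) (lookup-remove-self (E M) e)) λ ()
  contracted : ind (contract M ⁅ e ⁆) X ≡ (rank M (X ∪ ⁅ e ⁆) ≡ᵇ (∣ X ∣ ℕ.+ rank M ⁅ e ⁆))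
  contracted = cong (λ Z → rank M (X ∪ Z) ≡ᵇ (∣ X ∣ ℕ.+ rank M Z)) (⊆⇒∩≡ (⁅⁆⊆ e∈E))
  go : ∀ a → T (matches a (h e)) → T (ind (contract M ⁅ e ⁆) X) ⇔ Sparse (afterContracting a h e) X
  go 𝑍 match = subst (λ b → T b ⇔ Sparse h X) (sym ind≡)
    (⇔.trans T-≡ᵇ (⇔.trans (rank≡size⇔independent {M} {h} levelled X X⊆E) (levelled X X⊆E)))
    where
    he≡0 = ≡ᵇ⇒≡ (h e) 0 match
    ind≡ : ind (contract M ⁅ e ⁆) X ≡ (rank M X ≡ᵇ ∣ X ∣)
    ind≡ = trans contracted
      (cong₂ _≡ᵇ_ (rank-∪-loop {M} {h} levelled he≡0 X)
                  (trans (cong (∣ X ∣ ℕ.+_) (rank-loop {M} {h} levelled he≡0)) (ℕₚ.+-identityʳ _)))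
  go 𝐼 match = subst (λ b → T b ⇔ Sparse (lowerFrom (h e) ∘ h) X) (sym ind≡)
    (⇔.trans T-≡ᵇ (⇔.trans (rank≡size⇔independent {M} {h} levelled (X ∪ ⁅ e ⁆) X∪e⊆E)
                  (⇔.trans (levelled (X ∪ ⁅ e ⁆) X∪e⊆E) (sparse-insert h X e∉X (≤ᵇ⇒≤ 1 (h e) match)))))
    where
    X∪e⊆E = ∪-⊆ X⊆E (⁅⁆⊆ e∈E)
    rank⁅e⁆≡1 : rank M ⁅ e ⁆ ≡ 1
    rank⁅e⁆≡1 = trans (Equivalence.from (rank≡size⇔independent {M} {h} levelled ⁅ e ⁆ (⁅⁆⊆ e∈E))
                                         (subst T (sym (independent-singleton {M} {h} levelled e∈E)) match))
                      (∣⁅x⁆∣≡1 e)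
    ind≡ : ind (contract M ⁅ e ⁆) X ≡ (rank M (X ∪ ⁅ e ⁆) ≡ᵇ ∣ X ∪ ⁅ e ⁆ ∣)
    ind≡ = trans contracted
      (cong (rank M (X ∪ ⁅ e ⁆) ≡ᵇ_)
            (trans (cong (∣ X ∣ ℕ.+_) rank⁅e⁆≡1) (trans (ℕₚ.+-comm _ 1) (sym (∣insert∣ X e∉X)))))

T-allFinᵇ : ∀ {k} (P : Fin k → Bool) → T (allFinᵇ P) ⇔ (∀ i → T (P i))
T-allFinᵇ {zero}  P = mk⇔ (λ _ ()) (λ _ → tt)
T-allFinᵇ {suc k} P = mk⇔
  (λ all → let (P0 , rest) = Equivalence.to (T-∧ {P Fin.zero}) all
           in λ { Fin.zero → P0 ; (Fin.suc i) → Equivalence.to (T-allFinᵇ (P ∘ Fin.suc)) rest i })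
  (λ all → Equivalence.from (T-∧ {P Fin.zero})
             (all Fin.zero , Equivalence.from (T-allFinᵇ (P ∘ Fin.suc)) (all ∘ Fin.suc)))

module _ {n} (h : Levels n) (r : ℕ) (h≤r : ∀ i → h i ≤ r) (hits : ∀ (t : Fin r) → ∃ λ i → h i ≡ suc (toℕ t)) where

  levelSet : Fin (suc r) → Subset n
  levelSet t = tabulate λ i → h i ≤ᵇ toℕ t

  lookup-levelSet : ∀ t i → lookup (levelSet t) i ≡ (h i ≤ᵇ toℕ t)
  lookup-levelSet t i = lookup∘tabulate (λ j → h j ≤ᵇ toℕ t) i

  ∈levelSet : ∀ {i t} → h i ≤ toℕ t → i ∈ levelSet t
  ∈levelSet {i} {t} hi≤t = lookup⇒[]= i (levelSet t) (trans (lookup-levelSet t i) (≤ᵇ-true hi≤t))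

  ∈levelSet⁻ : ∀ {i t} → i ∈ levelSet t → h i ≤ toℕ t
  ∈levelSet⁻ {i} {t} i∈ =
    ≤ᵇ⇒≤ (h i) (toℕ t) (Equivalence.from T-≡ (trans (sym (lookup-levelSet t i)) ([]=⇒lookup i∈)))

  levelSet-strict : ∀ (t : Fin r) → levelSet (inject₁ t) ⊂ levelSet (Fin.suc t)
  levelSet-strict t =
    (λ i∈ → ∈levelSet (m≤n⇒m≤1+n (subst (_ ≤_) (toℕ-inject₁ t) (∈levelSet⁻ i∈)))) ,
    i , ∈levelSet (≤-reflexive hi≡t+1) ,
    λ i∈ → <⇒≱ (≤-reflexive (sym hi≡t+1)) (subst (h i ≤_) (toℕ-inject₁ t) (∈levelSet⁻ i∈))
    where
    i = proj₁ (hits t)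
    hi≡t+1 = proj₂ (hits t)

  levelFlag : Flag n
  levelFlag = record { r = r ; S = levelSet ; strict = levelSet-strict }

  levelFlag-ground : E (freedom levelFlag) ≡ ⊤
  levelFlag-ground = ⊆-antisym ⊆⊤ λ {i} _ → ∈levelSet (subst (h i ≤_) (sym (toℕ-fromℕ r)) (h≤r i))

  ∣∩levelSet∣ : ∀ X t → ∣ X ∩ levelSet t ∣ ≡ levelCount h X (toℕ t)
  ∣∩levelSet∣ X t = trans (∣∣≡count (X ∩ levelSet t))
    (count-cong λ i → trans (lookup-∩ X (levelSet t) i) (cong (lookup X i ∧_) (lookup-levelSet t i)))

  levelFlag-levelled : Levelled (freedom levelFlag) h
  levelFlag-levelled X _ = ⇔.trans (T-allFinᵇ _) (mk⇔ to from)
    where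
    to : (∀ t → T (∣ X ∩ levelSet t ∣ ≤ᵇ toℕ t)) → Sparse h X
    to bounded x with x ≤? r
    ... | yes x≤r = subst₂ _≤_ (trans (∣∩levelSet∣ X t) (cong (levelCount h X) t≡x)) t≡x
                      (≤ᵇ⇒≤ _ _ (bounded t))
      where t = fromℕ< (s≤s x≤r)
            t≡x = toℕ-fromℕ< (s≤s x≤r)
    ... | no  x≰r = ≤-trans (count-mono at-most-r)
                      (≤-trans (subst₂ _≤_ (trans (∣∩levelSet∣ X t) (cong (levelCount h X) t≡r)) t≡r
                                           (≤ᵇ⇒≤ _ _ (bounded t)))
                               (<⇒≤ (≰⇒> x≰r)))
      where t = fromℕ r
            t≡r = toℕ-fromℕ r
            at-most-r : ∀ i → T (lookup X i ∧ (h i ≤ᵇ x)) → T (lookup X i ∧ (h i ≤ᵇ r))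
            at-most-r i Xi,hi≤x = Equivalence.from T-∧ (proj₁ (Equivalence.to T-∧ Xi,hi≤x) , ≤⇒≤ᵇ (h≤r i))
    from : Sparse h X → ∀ t → T (∣ X ∩ levelSet t ∣ ≤ᵇ toℕ t)
    from sparse t = ≤⇒≤ᵇ (subst (_≤ toℕ t) (sym (∣∩levelSet∣ X t)) (sparse (toℕ t)))

wordFlag : (v : Word) → Flag (length v)
wordFlag v = levelFlag (wordLevels v) (#𝐼 v) (wordLevels≤#𝐼 v) (wordLevels-hits v)

wordMatroid : Word → SMatroid
wordMatroid v = freedom (wordFlag v)

wordMatroid-ground : ∀ v → E (wordMatroid v) ≡ ⊤
wordMatroid-ground v = levelFlag-ground (wordLevels v) (#𝐼 v) (wordLevels≤#𝐼 v) (wordLevels-hits v)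

wordMatroid-levelled : ∀ v → Levelled (wordMatroid v) (wordLevels v)
wordMatroid-levelled v = levelFlag-levelled (wordLevels v) (#𝐼 v) (wordLevels≤#𝐼 v) (wordLevels-hits v)

==W-sound : ∀ u w → T (u ==W w) → u ≡ w
==W-sound []      []      _         = refl
==W-sound (𝐼 ∷ u) (𝐼 ∷ w) u==w = cong (𝐼 ∷_) (==W-sound u w u==w)
==W-sound (𝑍 ∷ u) (𝑍 ∷ w) u==w = cong (𝑍 ∷_) (==W-sound u w u==w)

==W-refl : ∀ w → (w ==W w) ≡ true
==W-refl []      = refl
==W-refl (𝐼 ∷ w) = ==W-refl w
==W-refl (𝑍 ∷ w) = ==W-refl w

≢⇒≡ᵇ-false : ∀ {m n} → m ≢ n → (m ≡ᵇ n) ≡ false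
≢⇒≡ᵇ-false {m} {n} m≢n with m ≡ᵇ n in eq
... | true  = contradiction (≡ᵇ⇒≡ m n (subst T (sym eq) tt)) m≢n
... | false = refl

not-1≤ᵇ : ∀ l → not (1 ≤ᵇ l) ≡ (l ≡ᵇ 0)
not-1≤ᵇ zero    = refl
not-1≤ᵇ (suc l) = refl

-- Coefficients of words in A(𝓜)

module _ {c ℓ} (K : CommutativeRing c ℓ) where
  open CommutativeRing K hiding (-_; _-_) renaming (refl to ≈-refl; sym to ≈-sym; trans to ≈-trans)
  open MonoidSum +-monoid using (sum; sum-cong-≋)
  open import Relation.Binary.Reasoning.Setoid setoid
  open CommutativeSemigroupProperties +-commutativeSemigroup using (x∙yz≈y∙xz)

  natK-+ : ∀ m n → natK K (m ℕ.+ n) ≈ natK K m + natK K n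
  natK-+ zero    n = ≈-sym (+-identityˡ _)
  natK-+ (suc m) n = ≈-trans (+-congˡ (natK-+ m n)) (≈-sym (+-assoc _ _ _))

  natK-sum : ∀ {n} (f : Fin n → ℕ) → natK K (sumℕ f) ≈ sum (natK K ∘ f)
  natK-sum {zero}  f = ≈-refl
  natK-sum {suc n} f = ≈-trans (natK-+ (f Fin.zero) _) (+-congˡ (natK-sum (f ∘ Fin.suc)))

  natK-cancel : IsField K → CharZero K → ∀ {x m} → 0 < m → x * natK K m ≈ 0# → x ≈ 0#
  natK-cancel isField char0 {x} {suc m} _ x*m≈0 =
    let (y , m*y≈1) = IsField.inv isField (natK K (suc m)) (char0 m) in begin
      x                         ≈⟨ *-identityʳ x ⟨
      x * 1#                    ≈⟨ *-congˡ m*y≈1 ⟨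
      x * (natK K (suc m) * y)  ≈⟨ *-assoc _ _ _ ⟨
      x * natK K (suc m) * y    ≈⟨ *-congʳ x*m≈0 ⟩
      0# * y                    ≈⟨ zeroˡ y ⟩
      0#                        ∎

  sumList : ∀ {a} {A : Set a} → (A → Carrier) → List A → Carrier
  sumList f []       = 0#
  sumList f (x ∷ xs) = f x + sumList f xs

  sumList-cong : ∀ {a} {A : Set a} {f g : A → Carrier} xs → (∀ x → f x ≈ g x) → sumList f xs ≈ sumList g xs
  sumList-cong []       _   = ≈-refl
  sumList-cong (x ∷ xs) f≈g = +-cong (f≈g x) (sumList-cong xs f≈g)

  sumList-zero : ∀ {a} {A : Set a} {f : A → Carrier} xs → (∀ x → f x ≈ 0#) → sumList f xs ≈ 0#
  sumList-zero []       _   = ≈-refl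
  sumList-zero (x ∷ xs) f≈0 = ≈-trans (+-cong (f≈0 x) (sumList-zero xs f≈0)) (+-identityˡ 0#)

  sumList-+ : ∀ {a} {A : Set a} (f g : A → Carrier) xs →
              sumList f xs + sumList g xs ≈ sumList (λ x → f x + g x) xs
  sumList-+ f g []       = +-identityˡ 0#
  sumList-+ f g (x ∷ xs) = begin
    (f x + sumList f xs) + (g x + sumList g xs)  ≈⟨ +-assoc _ _ _ ⟩
    f x + (sumList f xs + (g x + sumList g xs))  ≈⟨ +-congˡ (x∙yz≈y∙xz _ _ _) ⟩
    f x + (g x + (sumList f xs + sumList g xs))  ≈⟨ +-assoc _ _ _ ⟨
    (f x + g x) + (sumList f xs + sumList g xs)  ≈⟨ +-congˡ (sumList-+ f g xs) ⟩
    (f x + g x) + sumList (λ x → f x + g x) xs   ∎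

  sumList-*ˡ : ∀ {a} {A : Set a} k (f : A → Carrier) xs → k * sumList f xs ≈ sumList (λ x → k * f x) xs
  sumList-*ˡ k f []       = zeroʳ k
  sumList-*ˡ k f (x ∷ xs) = ≈-trans (distribˡ k _ _) (+-congˡ (sumList-*ˡ k f xs))

  sumList-++ : ∀ {a} {A : Set a} (f : A → Carrier) xs ys → sumList f (xs ++ ys) ≈ sumList f xs + sumList f ys
  sumList-++ f []       ys = ≈-sym (+-identityˡ _)
  sumList-++ f (x ∷ xs) ys = ≈-trans (+-congˡ (sumList-++ f xs ys)) (≈-sym (+-assoc _ _ _))

  sumList-map : ∀ {a b} {A : Set a} {B : Set b} (f : B → Carrier) (g : A → B) xs →
                sumList f (map g xs) ≈ sumList (f ∘ g) xs
  sumList-map f g []       = ≈-refl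
  sumList-map f g (x ∷ xs) = +-congˡ (sumList-map f g xs)

  sumList-concatMap : ∀ {a b} {A : Set a} {B : Set b} (f : B → Carrier) (g : A → List B) xs →
                      sumList f (concatMap g xs) ≈ sumList (sumList f ∘ g) xs
  sumList-concatMap f g []       = ≈-refl
  sumList-concatMap f g (x ∷ xs) =
    ≈-trans (sumList-++ f (g x) (concatMap g xs)) (+-congˡ (sumList-concatMap f g xs))

  foldr-if≈sumList : ∀ {a} {A : Set a} (P : A → Bool) (g : A → Carrier) xs →
                     foldr (λ x acc → if P x then g x + acc else acc) 0# xs ≈
                     sumList (λ x → if P x then g x else 0#) xs
  foldr-if≈sumList P g []       = ≈-refl
  foldr-if≈sumList P g (x ∷ xs) with P x
  ... | true  = +-congˡ (foldr-if≈sumList P g xs)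
  ... | false = ≈-trans (foldr-if≈sumList P g xs) (≈-sym (+-identityˡ _))

  sum-allSubsets-suc : ∀ n (g : Subset (suc n) → Carrier) →
                       sumList g (allSubsets (suc n)) ≈
                       sumList (g ∘ (outside ∷_)) (allSubsets n) + sumList (g ∘ (inside ∷_)) (allSubsets n)
  sum-allSubsets-suc n g = begin
    sumList g (allSubsets (suc n))
      ≈⟨ sumList-concatMap g _ (allSubsets n) ⟩
    sumList (λ s → g (outside ∷ s) + (g (inside ∷ s) + 0#)) (allSubsets n)
      ≈⟨ sumList-cong (allSubsets n) (λ _ → +-congˡ (+-identityʳ _)) ⟩
    sumList (λ s → g (outside ∷ s) + g (inside ∷ s)) (allSubsets n)
      ≈⟨ sumList-+ _ _ (allSubsets n) ⟨
    sumList (g ∘ (outside ∷_)) (allSubsets n) + sumList (g ∘ (inside ∷_)) (allSubsets n) ∎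

  sum-allSubsets-empty : ∀ n (g : Subset n → Carrier) → (∀ A → ∣ A ∣ ≢ 0 → g A ≈ 0#) →
                         sumList g (allSubsets n) ≈ g Subset.⊥
  sum-allSubsets-empty zero    g nonempty≈0 = +-identityʳ _
  sum-allSubsets-empty (suc n) g nonempty≈0 = begin
    sumList g (allSubsets (suc n))                                          ≈⟨ sum-allSubsets-suc n g ⟩
    sumList (g ∘ (outside ∷_)) (allSubsets n) + sumList (g ∘ (inside ∷_)) (allSubsets n)
      ≈⟨ +-cong (sum-allSubsets-empty n (g ∘ (outside ∷_)) (nonempty≈0 ∘ (outside ∷_)))
                (sumList-zero (allSubsets n) (λ A → nonempty≈0 (inside ∷ A) λ ())) ⟩
    g Subset.⊥ + 0#  ≈⟨ +-identityʳ _ ⟩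
    g Subset.⊥       ∎

  sum-allSubsets-singletons : ∀ n (g : Subset n → Carrier) → (∀ A → ∣ A ∣ ≢ 1 → g A ≈ 0#) →
                              sumList g (allSubsets n) ≈ sum (g ∘ ⁅_⁆)
  sum-allSubsets-singletons zero    g non-singleton≈0 = ≈-trans (+-identityʳ _) (non-singleton≈0 [] λ ())
  sum-allSubsets-singletons (suc n) g non-singleton≈0 = begin
    sumList g (allSubsets (suc n))                                          ≈⟨ sum-allSubsets-suc n g ⟩
    sumList (g ∘ (outside ∷_)) (allSubsets n) + sumList (g ∘ (inside ∷_)) (allSubsets n)
      ≈⟨ +-cong (sum-allSubsets-singletons n (g ∘ (outside ∷_)) (non-singleton≈0 ∘ (outside ∷_)))
                (sum-allSubsets-empty n (g ∘ (inside ∷_))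
                                      (λ A ∣A∣≢0 → non-singleton≈0 (inside ∷ A) (∣A∣≢0 ∘ suc-injective))) ⟩
    sum (g ∘ ⁅_⁆ ∘ Fin.suc) + g ⁅ Fin.zero ⁆  ≈⟨ +-comm _ _ ⟩
    sum (g ∘ ⁅_⁆)                             ∎

  letterC-non-singleton : ∀ a M → ∣ E M ∣ ≢ 1 → letterC K a M ≈ 0#
  letterC-non-singleton 𝐼 M ∣E∣≢1 rewrite ≢⇒≡ᵇ-false ∣E∣≢1 = ≈-refl
  letterC-non-singleton 𝑍 M ∣E∣≢1 rewrite ≢⇒≡ᵇ-false ∣E∣≢1 = ≈-refl

  letterC-singleton : ∀ {M h} → Levelled M h → ∀ {e} → e ∈ E M → ∀ a →
                      letterC K a (restrict M ⁅ e ⁆) ≡ (if matches a (h e) then 1# else 0#)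
  letterC-singleton {M} {h} levelled {e} e∈E 𝐼
    rewrite ⊆⇒∩≡ (⁅⁆⊆ e∈E) | ∣⁅x⁆∣≡1 e | independent-singleton {M} {h} levelled e∈E = refl
  letterC-singleton {M} {h} levelled {e} e∈E 𝑍
    rewrite ⊆⇒∩≡ (⁅⁆⊆ e∈E) | ∣⁅x⁆∣≡1 e | independent-singleton {M} {h} levelled e∈E | not-1≤ᵇ (h e) = refl

  -- Only singletons A contribute to the product of a letter with another element, and M|{e} is
  -- the point or the loop according to the level of e.
  wordC-levelled : ∀ w M h → Levelled M h → wordC K w M ≈ natK K (orderings w (E M) h)
  wordC-levelled []      M h _ with ∣ E M ∣ ≡ᵇ 0
  ... | true  = ≈-sym (+-identityʳ 1#)
  ... | false = ≈-refl
  wordC-levelled (a ∷ w) M h levelled = begin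
    wordC K (a ∷ w) M                   ≈⟨ foldr-if≈sumList (λ A → ⌊ A ⊆? E M ⌋) term (allSubsets (size M)) ⟩
    sumList G (allSubsets (size M))     ≈⟨ sum-allSubsets-singletons (size M) G G-non-singleton ⟩
    sum (G ∘ ⁅_⁆)                       ≈⟨ sum-cong-≋ G-singleton ⟩
    sum (natK K ∘ summand)              ≈⟨ natK-sum summand ⟨
    natK K (orderings (a ∷ w) (E M) h)  ∎
    where
    term : Subset (size M) → Carrier
    term A = letterC K a (restrict M A) * wordC K w (contract M A)
    G : Subset (size M) → Carrier
    G A = if ⌊ A ⊆? E M ⌋ then term A else 0#
    summand : Fin (size M) → ℕ
    summand i = if lookup (E M) i ∧ matches a (h i) then orderings w (E M - i) (afterContracting a h i) else 0

    G-non-singleton : ∀ A → ∣ A ∣ ≢ 1 → G A ≈ 0#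
    G-non-singleton A ∣A∣≢1 with A ⊆? E M
    ... | no  _   = ≈-refl
    ... | yes A⊆E =
      ≈-trans (*-congʳ (letterC-non-singleton a (restrict M A) (∣A∣≢1 ∘ trans (sym (cong ∣_∣ (⊆⇒∩≡ A⊆E))))))
              (zeroˡ _)

    G-point : ∀ {i} → i ∈ E M →
              G ⁅ i ⁆ ≈ natK K (if matches a (h i) then orderings w (E M - i) (afterContracting a h i) else 0)
    G-point {i} i∈E rewrite ⌊⌋-true (⁅ i ⁆ ⊆? E M) (⁅⁆⊆ i∈E) | letterC-singleton {M} {h} levelled i∈E a
      with matches a (h i) in match
    ... | false = zeroˡ _
    ... | true  = ≈-trans (*-identityˡ _)
                    (wordC-levelled w (contract M ⁅ i ⁆) (afterContracting a h i)
                                    (contract-levelled {M} {h} levelled i∈E a (Equivalence.from T-≡ match)))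

    G-singleton : ∀ i → G ⁅ i ⁆ ≈ natK K (summand i)
    G-singleton i with lookup (E M) i in E∋i
    ... | false rewrite ⌊⌋-false (⁅ i ⁆ ⊆? E M) (⁅⁆⊈ E∋i) = ≈-refl
    ... | true = G-point (lookup⇒[]= i (E M) E∋i)

  evalWith : (Word → Carrier) → Poly K → Carrier
  evalWith g []            = 0#
  evalWith g ((a , w) ∷ P) = a * g w + evalWith g P

  evalC≈evalWith : ∀ P M → evalC K P M ≈ evalWith (λ w → wordC K w M) P
  evalC≈evalWith []      M = ≈-refl
  evalC≈evalWith (_ ∷ P) M = +-congˡ (evalC≈evalWith P M)

  evalWith-cong : ∀ {g g′ : Word → Carrier} P → (∀ w → g w ≈ g′ w) → evalWith g P ≈ evalWith g′ P
  evalWith-cong []            _    = ≈-refl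
  evalWith-cong ((a , w) ∷ P) g≈g′ = +-cong (*-congˡ (g≈g′ w)) (evalWith-cong P g≈g′)

  wordsOfLength : ℕ → List Word
  wordsOfLength zero    = [] ∷ []
  wordsOfLength (suc k) = map (𝐼 ∷_) (wordsOfLength k) ++ map (𝑍 ∷_) (wordsOfLength k)

  sum-wordsOfLength-indicator : ∀ k w x →
    sumList (λ u → if w ==W u then x else 0#) (wordsOfLength k) ≈ (if length w ≡ᵇ k then x else 0#)
  sum-wordsOfLength-indicator zero    []      x = +-identityʳ x
  sum-wordsOfLength-indicator zero    (_ ∷ _) x = +-identityʳ 0#
  sum-wordsOfLength-indicator (suc k) w       x = begin
    sumList indicator (map (𝐼 ∷_) words ++ map (𝑍 ∷_) words)
      ≈⟨ sumList-++ indicator (map (𝐼 ∷_) words) _ ⟩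
    sumList indicator (map (𝐼 ∷_) words) + sumList indicator (map (𝑍 ∷_) words)
      ≈⟨ +-cong (sumList-map indicator (𝐼 ∷_) words) (sumList-map indicator (𝑍 ∷_) words) ⟩
    sumList (indicator ∘ (𝐼 ∷_)) words + sumList (indicator ∘ (𝑍 ∷_)) words  ≈⟨ by-first-letter w ⟩
    (if length w ≡ᵇ suc k then x else 0#)                                    ∎
    where
    words = wordsOfLength k
    indicator : Word → Carrier
    indicator u = if w ==W u then x else 0#
    no-word : ∀ {f : Word → Carrier} → (∀ u → f u ≡ 0#) → sumList f words ≈ 0#
    no-word f≡0 = sumList-zero words (reflexive ∘ f≡0)
    by-first-letter : ∀ w → sumList (λ u → if w ==W (𝐼 ∷ u) then x else 0#) words
                          + sumList (λ u → if w ==W (𝑍 ∷ u) then x else 0#) words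
                          ≈ (if length w ≡ᵇ suc k then x else 0#)
    by-first-letter []      = ≈-trans (+-cong (no-word λ _ → refl) (no-word λ _ → refl)) (+-identityʳ 0#)
    by-first-letter (𝐼 ∷ w) =
      ≈-trans (+-cong (sum-wordsOfLength-indicator k w x) (no-word λ _ → refl)) (+-identityʳ _)
    by-first-letter (𝑍 ∷ w) =
      ≈-trans (+-cong (no-word λ _ → refl) (sum-wordsOfLength-indicator k w x)) (+-identityˡ _)

  evalWith-collect : ∀ k (g : Word → Carrier) → (∀ w → length w ≢ k → g w ≈ 0#) → ∀ P →
                     evalWith g P ≈ sumList (λ u → coeff K P u * g u) (wordsOfLength k)
  evalWith-collect k g vanishes [] = ≈-sym (sumList-zero (wordsOfLength k) (λ u → zeroˡ (g u)))
  evalWith-collect k g vanishes ((a , w) ∷ P) = begin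
    a * g w + evalWith g P
      ≈⟨ +-cong (*-congˡ g-as-sum) (evalWith-collect k g vanishes P) ⟩
    a * sumList (λ u → if w ==W u then g u else 0#) words + sumList (λ u → coeff K P u * g u) words
      ≈⟨ +-congʳ (sumList-*ˡ a _ words) ⟩
    sumList (λ u → a * (if w ==W u then g u else 0#)) words + sumList (λ u → coeff K P u * g u) words
      ≈⟨ sumList-+ _ _ words ⟩
    sumList (λ u → a * (if w ==W u then g u else 0#) + coeff K P u * g u) words
      ≈⟨ sumList-cong words add-term ⟩
    sumList (λ u → coeff K ((a , w) ∷ P) u * g u) words ∎
    where
    words = wordsOfLength k
    g-as-sum : g w ≈ sumList (λ u → if w ==W u then g u else 0#) words
    g-as-sum = ≈-sym (begin
      sumList (λ u → if w ==W u then g u else 0#) words  ≈⟨ sumList-cong words at-w ⟩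
      sumList (λ u → if w ==W u then g w else 0#) words  ≈⟨ sum-wordsOfLength-indicator k w (g w) ⟩
      (if length w ≡ᵇ k then g w else 0#)                ≈⟨ length-k (length w ≡ᵇ k) refl ⟩
      g w                                                ∎)
      where
      at-w : ∀ u → (if w ==W u then g u else 0#) ≈ (if w ==W u then g w else 0#)
      at-w u with w ==W u in w==u
      ... | true  = reflexive (cong g (sym (==W-sound w u (Equivalence.from T-≡ w==u))))
      ... | false = ≈-refl
      length-k : ∀ b → (length w ≡ᵇ k) ≡ b → (if b then g w else 0#) ≈ g w
      length-k true  _     = ≈-refl
      length-k false ≢k    =
        ≈-sym (vanishes w λ ≡k → contradiction (trans (sym ≢k) (Equivalence.to T-≡ (≡⇒≡ᵇ _ _ ≡k))) λ ())
    add-term : ∀ u → a * (if w ==W u then g u else 0#) + coeff K P u * g u ≈ coeff K ((a , w) ∷ P) u * g u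
    add-term u with w ==W u
    ... | true  = ≈-sym (distribʳ (g u) a (coeff K P u))
    ... | false = ≈-trans (+-congʳ (zeroʳ a)) (+-identityˡ _)

  diagonal-term≈0 : ∀ P v → (∀ u → index u < index v → coeff K P u ≈ 0#) →
                    evalC K P (wordMatroid v) ≈ 0# →
                    coeff K P v * natK K (orderings v ⊤ (wordLevels v)) ≈ 0#
  diagonal-term≈0 P v lower≈0 P≈0 = begin
    X                                                ≈⟨ reflexive (cong (λ b → if b then X else 0#) ≡ᵇ-refl) ⟨
    (if length v ≡ᵇ length v then X else 0#)         ≈⟨ sum-wordsOfLength-indicator (length v) v X ⟨
    sumList (λ u → if v ==W u then X else 0#) words  ≈⟨ sumList-cong words only-v ⟨
    sumList (λ u → coeff K P u * g u) words          ≈⟨ evalWith-collect (length v) g off-length P ⟨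
    evalWith g P                                     ≈⟨ evalWith-cong P coefficient ⟨
    evalWith (λ w → wordC K w (wordMatroid v)) P     ≈⟨ evalC≈evalWith P (wordMatroid v) ⟨
    evalC K P (wordMatroid v)                        ≈⟨ P≈0 ⟩
    0#                                               ∎
    where
    g : Word → Carrier
    g u = natK K (orderings u ⊤ (wordLevels v))
    X = coeff K P v * g v
    words = wordsOfLength (length v)
    ≡ᵇ-refl : (length v ≡ᵇ length v) ≡ true
    ≡ᵇ-refl = Equivalence.to T-≡ (≡⇒≡ᵇ (length v) (length v) refl)

    coefficient : ∀ w → wordC K w (wordMatroid v) ≈ g w
    coefficient w = ≈-trans (wordC-levelled w (wordMatroid v) (wordLevels v) (wordMatroid-levelled v))
                            (reflexive (cong (λ D → natK K (orderings w D (wordLevels v))) (wordMatroid-ground v)))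

    off-length : ∀ u → length u ≢ length v → g u ≈ 0#
    off-length u ≢length with orderings u ⊤ (wordLevels v) in positive
    ... | zero  = ≈-refl
    ... | suc _ = contradiction (proj₁ (orderings-triangular u v (subst (0 <_) (sym positive) z<s))) ≢length

    only-v : ∀ u → coeff K P u * g u ≈ (if v ==W u then X else 0#)
    only-v u with v ==W u in v==u
    ... | true with ==W-sound v u (Equivalence.from T-≡ v==u)
    ...   | refl = ≈-refl
    only-v u | false with orderings u ⊤ (wordLevels v) in positive
    ...   | zero  = zeroʳ _
    ...   | suc _ =
      ≈-trans (*-congʳ (lower≈0 u (proj₂ (orderings-triangular u v (subst (0 <_) (sym positive) z<s)) u≢v)))
              (zeroˡ _)
      where
      u≢v : u ≢ v
      u≢v refl = contradiction (trans (sym (==W-refl v)) v==u) λ ()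

corollary8p2 : ∀ {c ℓ p} (K : CommutativeRing c ℓ) → IsField K → CharZero K →
    (𝓜 : SMatroid → Set p) → MinorClosedClass 𝓜 →
    (∀ n (F : Flag n) → 𝓜 (freedom F)) →
    (P : Poly K) →
    (∀ M → 𝓜 M → CommutativeRing._≈_ K (evalC K P M) (CommutativeRing.0# K)) →
    ∀ (u : Word) → CommutativeRing._≈_ K (coeff K P u) (CommutativeRing.0# K)
corollary8p2 K isField char0 𝓜 _ freedom∈𝓜 P P≈0 u = <-rec Goal step (index u) u refl
  where
  open CommutativeRing K using (_≈_; 0#)
  Goal : ℕ → Set _
  Goal k = ∀ v → index v ≡ k → coeff K P v ≈ 0#
  step : ∀ k → (∀ {j} → j < k → Goal j) → Goal k
  step _ smaller v refl =
    natK-cancel K isField char0 (orderings-diagonal v)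
      (diagonal-term≈0 K P v (λ u u<v → smaller u<v u refl)
                             (P≈0 (wordMatroid v) (freedom∈𝓜 (length v) (wordFlag v))))
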